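{- Let $M$ be a closed term such that $\vdash^{w}M:\mathbf{0}$ is derivable. Then there exists $k\in\mathbb{N}$ such that $w\le\mathcal{E}_k(M)$.
   Context: Terms: values $V ::= x \mid \lambda x.M$; terms $M ::= V \mid VV \mid M\oplus M \mid \mathtt{let}\ x = M\ \mathtt{in}\ M$; $M\{V/x\}$ is capture-avoiding substitution. A multidistribution on terms is a finite multiset $\langle p_iM_i\rangle_{i\in I}$ with $p_i\in(0,1]$, $\sum_ip_i\le1$; $\sqcup$ is multiset union and $q\cdot\langle p_iM_i\rangle=\langle (qp_i)M_i\rangle$. One-step reduction: $(\lambda x.M)V\to\langle 1\,M\{V/x\}\rangle$; $\mathtt{let}\ x=V\ \mathtt{in}\ M\to\langle 1\,M\{V/x\}\rangle$; $M\oplus N\to\langle\tfrac12 M,\tfrac12 N\rangle$; if $N\to\langle p_iN_i\rangle_{i\in I}$ then $\mathtt{let}\ x=N\ \mathtt{in}\ M\to\langle p_i(\mathtt{let}\ x=N_i\ \mathtt{in}\ M)\rangle_{i\in I}$. Lifting to multidistributions of closed terms: $\langle p_iM_i\rangle_{i\in I}\Rightarrow\bigsqcup_i p_i\cdot\mathbf{m}_i$ where $\mathbf{m}_i=\langle 1M_i\rangle$ if $M_i$ is a value and $M_i\to\mathbf{m}_i$ otherwise. For closed $M$ let $\langle 1M\rangle=\mathbf{m}_0\Rightarrow\mathbf{m}_1\Rightarrow\cdots$; $\mathcal{P}_k(M)$ is the sum of the probabilities of the values occurring in $\mathbf{m}_k$, and $\mathcal{E}_k(M)=\sum_{j=0}^{k-1}(1-\mathcal{P}_j(M))$.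 Types: arrow types $\mathtt{A} ::= \mathcal{M}\to \mathtt{a}$; intersection types $\mathcal{M} ::= [q_1\cdot \mathtt{A}_1,\dots,q_n\cdot\mathtt{A}_n]$ ($n\ge0$, scale factors $q_i\in(0,1]\cap\mathbb{Q}$); type distributions $\mathtt{a} ::= \langle p_1\mathcal{M}_1,\dots,p_n\mathcal{M}_n\rangle$ ($n\ge0$, $p_i\in(0,1]$, $\sum p_i\le1$); $\mathbf{0}$ is the empty type distribution. Scaling: $u\cdot[q_i\cdot\mathtt{A}_i]_i=[(uq_i)\cdot \mathtt{A}_i]_i$, $u\cdot\langle p_i\mathcal{M}_i\rangle_i=\langle (up_i)\mathcal{M}_i\rangle_i$; $\uplus,\sqcup$ multiset unions. Typing contexts map variables to intersection types (finitely many nonempty), pointwise $\uplus$ and scaling. Rules for $\Gamma\vdash^{w}M:\tau$ ($w\in\mathbb{Q}$): (Var) $x:\mathcal{M}\vdash^0 x:\mathcal{M}$. (Zero) $\vdash^0 M:\mathbf{0}$. (@) from $\Gamma\vdash^{w}V:[1\cdot(\mathcal{M}\to\mathtt{b})]$, $\Delta\vdash^{v}W:\mathcal{M}$ infer $\Gamma\uplus\Delta\vdash^{w+v}VW:\mathtt{b}$. ($\oplus$) from $\Gamma\vdash^{w}M:\mathtt{a}$, $\Delta\vdash^{v}N:\mathtt{b}$ infer $\tfrac12\cdot\Gamma\uplus\tfrac12\cdot\Delta\vdash^{\frac12 w+\frac12 v+1}M\oplus N:\tfrac12\mathtt{a}\sqcup\tfrac12\mathtt{b}$. ($\lambda$)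 from $\Gamma,x:\mathcal{M}\vdash^{w}M:\mathtt{b}$ infer $\Gamma\vdash^{w+1}\lambda x.M:\mathcal{M}\to\mathtt{b}$. (let) from $\Gamma\vdash^{v}N:\langle p_k\mathcal{M}_k\rangle_{k\in K}$ and $\Delta_k,x:\mathcal{M}_k\vdash^{w_k}M:\mathtt{b}_k$ ($k\in K$) infer $\Gamma\uplus_{k}p_k\cdot\Delta_k\vdash^{\sum_k p_kw_k+v+1}\mathtt{let}\ x=N\ \mathtt{in}\ M:\bigsqcup_k p_k\mathtt{b}_k$. (Val) from $\Gamma\vdash^{w}V:\mathcal{M}$ infer $\Gamma\vdash^{w}V:\langle 1\mathcal{M}\rangle$. (!) for finite possibly empty $I$, from $\Gamma_i\vdash^{w_i}V:\mathtt{A}_i$ and scale factors $q_i$ infer $\uplus_i q_i\cdot\Gamma_i\vdash^{\sum_i q_iw_i}V:[q_i\cdot\mathtt{A}_i]_{i\in I}$. -}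

module Defs where

open import Data.Nat using (ℕ; zero; suc)
open import Data.Fin using (Fin; zero; suc)
open import Data.Rational using (ℚ; 0ℚ; 1ℚ; ½; _+_; _*_; _-_; _≤_; _<_)
open import Data.List using (List; []; _∷_; _++_; map; concatMap)
open import Data.Vec using (Vec; []; _∷_; replicate; zipWith)
import Data.Vec
open import Data.Product using (_×_; _,_; proj₁; proj₂)
open import Data.Unit using (⊤)
open import Relation.Binary.PropositionalEquality using (_≡_)

-- Terms (well-scoped de Bruijn syntax; Tm n = terms with free variables
-- among n; variable 'zero' is the most recently bound one)

mutual
  data Val (n : ℕ) : Set where
    var : Fin n → Val n
    lam : Tm (suc n) → Val n

  data Tm (n : ℕ) : Set where
    val  : Val n → Tm n
    app  : Val n → Val n → Tm n
    _⊕_  : Tm n → Tm n → Tm n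
    letin : Tm n → Tm (suc n) → Tm n

mutual
  renV : ∀ {m n} → (Fin m → Fin n) → Val m → Val n
  renV ρ (var x) = var (ρ x)
  renV ρ (lam M) = lam (renT (ext ρ) M)

  renT : ∀ {m n} → (Fin m → Fin n) → Tm m → Tm n
  renT ρ (val V) = val (renV ρ V)
  renT ρ (app V W) = app (renV ρ V) (renV ρ W)
  renT ρ (M ⊕ N) = renT ρ M ⊕ renT ρ N
  renT ρ (letin N M) = letin (renT ρ N) (renT (ext ρ) M)

  ext : ∀ {m n} → (Fin m → Fin n) → Fin (suc m) → Fin (suc n)
  ext ρ zero = zero
  ext ρ (suc x) = suc (ρ x)

exts : ∀ {m n} → (Fin m → Val n) → Fin (suc m) → Val (suc n)
exts σ zero = var zero
exts σ (suc x) = renV suc (σ x)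

mutual
  subV : ∀ {m n} → (Fin m → Val n) → Val m → Val n
  subV σ (var x) = σ x
  subV σ (lam M) = lam (subT (exts σ) M)

  subT : ∀ {m n} → (Fin m → Val n) → Tm m → Tm n
  subT σ (val V) = val (subV σ V)
  subT σ (app V W) = app (subV σ V) (subV σ W)
  subT σ (M ⊕ N) = subT σ M ⊕ subT σ N
  subT σ (letin N M) = letin (subT σ N) (subT (exts σ) M)

_[_] : ∀ {n} → Tm (suc n) → Val n → Tm n
M [ V ] = subT σ M
  where
  σ : _
  σ zero = V
  σ (suc x) = var x

-- Multidistributions of closed terms: finite multisets (lists) of
-- (probability, term) pairs; ⊔ is _++_.

MDist : Set
MDist = List (ℚ × Tm 0)

scaleMD : ℚ → MDist → MDist
scaleMD q = map (λ pM → (q * proj₁ pM , proj₂ pM))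

-- The one-step reduction M → m of a closed non-value term, merged with
-- the convention m = ⟨1 M⟩ for a value M (this is the m_i of the lifting).
-- Reduction is deterministic, so it is given as a function.
stepT : Tm 0 → MDist
stepT (val V) = (1ℚ , val V) ∷ []
stepT (app (var ()) W)
stepT (app (lam M) V) = (1ℚ , M [ V ]) ∷ []
stepT (M ⊕ N) = (½ , M) ∷ (½ , N) ∷ []
stepT (letin (val V) M) = (1ℚ , M [ V ]) ∷ []
stepT (letin (app V W) M) = map (λ pN → (proj₁ pN , letin (proj₂ pN) M)) (stepT (app V W))
stepT (letin (N₁ ⊕ N₂) M) = map (λ pN → (proj₁ pN , letin (proj₂ pN) M)) (stepT (N₁ ⊕ N₂))
stepT (letin (letin N₁ N₂) M) = map (λ pN → (proj₁ pN , letin (proj₂ pN) M)) (stepT (letin N₁ N₂))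

lift : MDist → MDist
lift = concatMap (λ pM → scaleMD (proj₁ pM) (stepT (proj₂ pM)))

mseq : Tm 0 → ℕ → MDist
mseq M zero = (1ℚ , M) ∷ []
mseq M (suc k) = lift (mseq M k)

valueWeight : ℚ × Tm 0 → ℚ
valueWeight (p , val V) = p
valueWeight (p , app V W) = 0ℚ
valueWeight (p , M ⊕ N) = 0ℚ
valueWeight (p , letin N M) = 0ℚ

valueMass : MDist → ℚ
valueMass [] = 0ℚ
valueMass (e ∷ m) = valueWeight e + valueMass m

𝒫 : ℕ → Tm 0 → ℚ
𝒫 k M = valueMass (mseq M k)

ℰ : ℕ → Tm 0 → ℚ
ℰ zero M = 0ℚ
ℰ (suc k) M = ℰ k M + (1ℚ - 𝒫 k M)

-- Types.  Multisets are represented by lists, and multiset equality is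
-- the congruence _≈…_ below (permutation at every nesting level).

mutual
  data Arrow : Set where
    _⇒_ : Inter → Dist → Arrow

  Inter : Set
  Inter = List (ℚ × Arrow)

  Dist : Set
  Dist = List (ℚ × Inter)

𝟎 : Dist
𝟎 = []

data Perm {A : Set} (R : A → A → Set) : List A → List A → Set where
  nil   : Perm R [] []
  cons  : ∀ {x y xs ys} → R x y → Perm R xs ys → Perm R (x ∷ xs) (y ∷ ys)
  swap  : ∀ {x y xs} → Perm R (x ∷ y ∷ xs) (y ∷ x ∷ xs)
  trans : ∀ {xs ys zs} → Perm R xs ys → Perm R ys zs → Perm R xs zs

mutual
  data _≈A_ : Arrow → Arrow → Set where
    arr : ∀ {𝓜 𝓝 a b} → 𝓜 ≈I 𝓝 → a ≈D b → (𝓜 ⇒ a) ≈A (𝓝 ⇒ b)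

  data _≈qA_ : ℚ × Arrow → ℚ × Arrow → Set where
    el : ∀ {q A B} → A ≈A B → (q , A) ≈qA (q , B)

  data _≈pI_ : ℚ × Inter → ℚ × Inter → Set where
    el : ∀ {p 𝓜 𝓝} → 𝓜 ≈I 𝓝 → (p , 𝓜) ≈pI (p , 𝓝)

  data _≈I_ : Inter → Inter → Set where
    perm : ∀ {𝓜 𝓝} → Perm _≈qA_ 𝓜 𝓝 → 𝓜 ≈I 𝓝

  data _≈D_ : Dist → Dist → Set where
    perm : ∀ {a b} → Perm _≈pI_ a b → a ≈D b

InUnit : ℚ → Set
InUnit q = (0ℚ < q) × (q ≤ 1ℚ)

sumP : Dist → ℚ
sumP [] = 0ℚ
sumP ((p , _) ∷ a) = p + sumP a

mutual
  data WFA : Arrow → Set where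
    arr : ∀ {𝓜 a} → WFI 𝓜 → WFD a → WFA (𝓜 ⇒ a)

  data WFI : Inter → Set where
    []  : WFI []
    _∷_ : ∀ {q A 𝓜} → InUnit q × WFA A → WFI 𝓜 → WFI ((q , A) ∷ 𝓜)

  data WFD' : Dist → Set where
    []  : WFD' []
    _∷_ : ∀ {p 𝓜 a} → InUnit p × WFI 𝓜 → WFD' a → WFD' ((p , 𝓜) ∷ a)

  data WFD : Dist → Set where
    wfd : ∀ {a} → WFD' a → sumP a ≤ 1ℚ → WFD a

scaleI : ℚ → Inter → Inter
scaleI u = map (λ qA → (u * proj₁ qA , proj₂ qA))

scaleD : ℚ → Dist → Dist
scaleD u = map (λ pM → (u * proj₁ pM , proj₂ pM))

-- typing contexts: an intersection type for each variable in scope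
-- (the empty intersection type [] meaning that the variable is absent)
Ctx : ℕ → Set
Ctx n = Vec Inter n

∅ : ∀ {n} → Ctx n
∅ = replicate _ []

_⊎C_ : ∀ {n} → Ctx n → Ctx n → Ctx n
_⊎C_ = zipWith _++_

scaleC : ∀ {n} → ℚ → Ctx n → Ctx n
scaleC u = Data.Vec.map (scaleI u)

_≈C_ : ∀ {n} → Ctx n → Ctx n → Set
[] ≈C [] = ⊤
(𝓜 ∷ Γ) ≈C (𝓝 ∷ Δ) = (𝓜 ≈I 𝓝) × (Γ ≈C Δ)

single : ∀ {n} → Fin n → Inter → Ctx n
single zero 𝓜 = 𝓜 ∷ ∅
single (suc x) 𝓜 = [] ∷ single x 𝓜

mutual
  data _⊢A_∣_∶_ {n : ℕ} : Ctx n → ℚ → Val n → Arrow → Set where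
    lamR : ∀ {Γ 𝓜 w M b} → (𝓜 ∷ Γ) ⊢T w ∣ M ∶ b → Γ ⊢A (w + 1ℚ) ∣ lam M ∶ (𝓜 ⇒ b)
    convA : ∀ {Γ Γ' w V A A'} → Γ ⊢A w ∣ V ∶ A → Γ ≈C Γ' → A ≈A A' → Γ' ⊢A w ∣ V ∶ A'

  data _⊢I_∣_∶_ {n : ℕ} : Ctx n → ℚ → Val n → Inter → Set where
    varR : ∀ {x 𝓜} → WFI 𝓜 → single x 𝓜 ⊢I 0ℚ ∣ var x ∶ 𝓜
    bangR : ∀ {Γ w V 𝓜} → Bang V Γ w 𝓜 → Γ ⊢I w ∣ V ∶ 𝓜
    convI : ∀ {Γ Γ' w V 𝓜 𝓜'} → Γ ⊢I w ∣ V ∶ 𝓜 → Γ ≈C Γ' → 𝓜 ≈I 𝓜' → Γ' ⊢I w ∣ V ∶ 𝓜'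

  -- premises of (!):  Bang V (⊎ᵢ qᵢ·Γᵢ) (Σᵢ qᵢwᵢ) [qᵢ·Aᵢ]ᵢ
  data Bang {n : ℕ} (V : Val n) : Ctx n → ℚ → Inter → Set where
    none : Bang V ∅ 0ℚ []
    more : ∀ {Γ w A q Γ' w' 𝓜} → InUnit q → Γ ⊢A w ∣ V ∶ A → Bang V Γ' w' 𝓜 →
           Bang V (scaleC q Γ ⊎C Γ') (q * w + w') ((q , A) ∷ 𝓜)

  data _⊢T_∣_∶_ {n : ℕ} : Ctx n → ℚ → Tm n → Dist → Set where
    zeroR : ∀ {M} → ∅ ⊢T 0ℚ ∣ M ∶ 𝟎
    appR : ∀ {Γ Δ w v V W 𝓜 b} → Γ ⊢I w ∣ V ∶ ((1ℚ , (𝓜 ⇒ b)) ∷ []) → Δ ⊢I v ∣ W ∶ 𝓜 →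
           (Γ ⊎C Δ) ⊢T (w + v) ∣ app V W ∶ b
    plusR : ∀ {Γ Δ w v M N a b} → Γ ⊢T w ∣ M ∶ a → Δ ⊢T v ∣ N ∶ b →
            (scaleC ½ Γ ⊎C scaleC ½ Δ) ⊢T (½ * w + ½ * v + 1ℚ) ∣ M ⊕ N ∶ (scaleD ½ a ++ scaleD ½ b)
    letR : ∀ {Γ Δ v w N M K b} → Γ ⊢T v ∣ N ∶ K → LetPrem M K Δ w b →
           (Γ ⊎C Δ) ⊢T (w + v + 1ℚ) ∣ letin N M ∶ b
    valR : ∀ {Γ w V 𝓜} → Γ ⊢I w ∣ V ∶ 𝓜 → Γ ⊢T w ∣ val V ∶ ((1ℚ , 𝓜) ∷ [])
    convT : ∀ {Γ Γ' w M a a'} → Γ ⊢T w ∣ M ∶ a → Γ ≈C Γ' → a ≈D a' → Γ' ⊢T w ∣ M ∶ a'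

  -- premises of (let) for N : ⟨p_k 𝓜_k⟩_k :
  --   LetPrem M ⟨p_k 𝓜_k⟩_k (⊎_k p_k·Δ_k) (Σ_k p_k w_k) (⊔_k p_k b_k)
  data LetPrem {n : ℕ} (M : Tm (suc n)) : Dist → Ctx n → ℚ → Dist → Set where
    none : LetPrem M [] ∅ 0ℚ []
    more : ∀ {p 𝓜 K Δ w b Δ' w' b'} → (𝓜 ∷ Δ) ⊢T w ∣ M ∶ b → LetPrem M K Δ' w' b' →
           LetPrem M ((p , 𝓜) ∷ K) (scaleC p Δ ⊎C Δ') (p * w + w') (scaleD p b ++ b')

-- Subject reduction: a closed
-- non-value typed with weight w by a derivation of size s reduces to a
-- multidistribution ⟨pᵢ Nᵢ⟩ whose entries are typed, by derivations of size
-- smaller than s, with weights wᵢ such that w ≤ 1 + Σᵢ pᵢwᵢ (the β- and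
-- let-redexes rely on the substitution lemma, which adds up weights). Since
-- the non-values of m_j carry mass 1 − 𝒫_j(M), the quantity
-- ℰ_j(M) + Σᵢ pᵢwᵢ over the entries of m_j never drops below w. Each entry
-- has at most two successors, so the measure Σᵢ F(sᵢ) with F(s+1) = 2 + 3F(s)
-- strictly decreases until it reaches 0; then every derivation has size 0,
-- hence weight 0, and w ≤ ℰ_k(M).
module Submission where

open import Defs
open import Data.Nat using (ℕ; zero; suc; z≤n; s≤s) renaming (_+_ to _+ℕ_; _<_ to _<ℕ_; _≤_ to _≤ℕ_)
import Data.Nat.Properties as NP
open import Data.Fin using (Fin; zero; suc)
open import Data.Product using (∃; Σ; _×_; _,_; proj₁; proj₂)
open import Data.Sum using (_⊎_; inj₁; inj₂)
open import Data.Rational using (ℚ; 0ℚ; 1ℚ; ½; _+_; _*_; _-_; _≤_; nonNegative)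
import Data.Rational.Properties as QP
open import Data.Rational.Solver
open +-*-Solver using (solve; _:+_; _:*_; _:=_; con; _:-_)
open import Data.List using (List; []; _∷_; _++_; map; length)
import Data.List.Properties as LP
open import Data.List.Relation.Unary.All using (All; []; _∷_)
open import Data.Vec using ([]; _∷_)
open import Data.Unit using (tt)
open import Data.Empty using (⊥-elim)
import Relation.Nullary.Decidable as Dec
open import Relation.Binary.PropositionalEquality hiding ([_]) renaming (trans to ≡trans)
open import Algebra.Bundles using (CommutativeMonoid)
import Algebra.Properties.CommutativeSemigroup as CommSemigroupProperties

module ℚ+ = CommSemigroupProperties (CommutativeMonoid.commutativeSemigroup QP.+-0-commutativeMonoid)
module ℕ+ = CommSemigroupProperties NP.+-commutativeSemigroup

module _ {A : Set} {R : A → A → Set} where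

  Perm-[]ˡ : ∀ {ys} → Perm R [] ys → ys ≡ []
  Perm-[]ˡ nil = refl
  Perm-[]ˡ (trans p q) with Perm-[]ˡ p
  ... | refl = Perm-[]ˡ q

  Perm-[]ʳ : ∀ {xs} → Perm R xs [] → xs ≡ []
  Perm-[]ʳ nil = refl
  Perm-[]ʳ (trans p q) with Perm-[]ʳ q
  ... | refl = Perm-[]ʳ p

  Perm-[-]ʳ : (∀ {x y z} → R x y → R y z → R x z) → ∀ {xs y} → Perm R xs (y ∷ []) → Σ A λ x → xs ≡ x ∷ [] × R x y
  Perm-[-]ʳ R-trans (cons r p) with Perm-[]ʳ p
  ... | refl = _ , refl , r
  Perm-[-]ʳ R-trans (trans p q) with Perm-[-]ʳ R-trans q
  ... | y' , refl , r with Perm-[-]ʳ R-trans p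
  ... | x , refl , r' = x , refl , R-trans r' r

  Perm-map : {B : Set} {S : B → B → Set} (f : A → B) → (∀ {x y} → R x y → S (f x) (f y)) →
             ∀ {xs ys} → Perm R xs ys → Perm S (map f xs) (map f ys)
  Perm-map f f-cong nil = nil
  Perm-map f f-cong (cons r p) = cons (f-cong r) (Perm-map f f-cong p)
  Perm-map f f-cong swap = swap
  Perm-map f f-cong (trans p q) = trans (Perm-map f f-cong p) (Perm-map f f-cong q)

module _ {A : Set} {R : A → A → Set} (R-refl : ∀ x → R x x) where

  Perm-refl : ∀ xs → Perm R xs xs
  Perm-refl [] = nil
  Perm-refl (x ∷ xs) = cons (R-refl x) (Perm-refl xs)

  Perm-++ˡ : ∀ {xs xs'} ys → Perm R xs xs' → Perm R (xs ++ ys) (xs' ++ ys)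
  Perm-++ˡ ys nil = Perm-refl ys
  Perm-++ˡ ys (cons r p) = cons r (Perm-++ˡ ys p)
  Perm-++ˡ ys swap = swap
  Perm-++ˡ ys (trans p q) = trans (Perm-++ˡ ys p) (Perm-++ˡ ys q)

  Perm-++ʳ : ∀ xs {ys ys'} → Perm R ys ys' → Perm R (xs ++ ys) (xs ++ ys')
  Perm-++ʳ [] p = p
  Perm-++ʳ (x ∷ xs) p = cons (R-refl x) (Perm-++ʳ xs p)

  Perm-++ : ∀ {xs xs' ys ys'} → Perm R xs xs' → Perm R ys ys' → Perm R (xs ++ ys) (xs' ++ ys')
  Perm-++ {xs' = xs'} {ys} p q = trans (Perm-++ˡ ys p) (Perm-++ʳ xs' q)

  Perm-shift : ∀ xs y ys → Perm R (y ∷ (xs ++ ys)) (xs ++ (y ∷ ys))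
  Perm-shift [] y ys = Perm-refl (y ∷ ys)
  Perm-shift (x ∷ xs) y ys = trans swap (cons (R-refl x) (Perm-shift xs y ys))

  Perm-++-comm : ∀ xs ys → Perm R (xs ++ ys) (ys ++ xs)
  Perm-++-comm [] ys = subst (Perm R ys) (sym (LP.++-identityʳ ys)) (Perm-refl ys)
  Perm-++-comm (x ∷ xs) ys = trans (cons (R-refl x) (Perm-++-comm xs ys)) (Perm-shift ys x xs)

mutual
  ≈A-refl : ∀ A → A ≈A A
  ≈A-refl (𝓜 ⇒ a) = arr (≈I-refl 𝓜) (≈D-refl a)

  ≈I-refl : ∀ 𝓜 → 𝓜 ≈I 𝓜
  ≈I-refl 𝓜 = perm (Perm≈qA-refl 𝓜)

  Perm≈qA-refl : ∀ 𝓜 → Perm _≈qA_ 𝓜 𝓜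
  Perm≈qA-refl [] = nil
  Perm≈qA-refl ((q , A) ∷ 𝓜) = cons (el (≈A-refl A)) (Perm≈qA-refl 𝓜)

  ≈D-refl : ∀ a → a ≈D a
  ≈D-refl a = perm (Perm≈pI-refl a)

  Perm≈pI-refl : ∀ a → Perm _≈pI_ a a
  Perm≈pI-refl [] = nil
  Perm≈pI-refl ((p , 𝓜) ∷ a) = cons (el (≈I-refl 𝓜)) (Perm≈pI-refl a)

≈qA-refl : ∀ x → x ≈qA x
≈qA-refl (q , A) = el (≈A-refl A)

≈pI-refl : ∀ x → x ≈pI x
≈pI-refl (p , 𝓜) = el (≈I-refl 𝓜)

mutual
  ≈A-sym : ∀ {A B} → A ≈A B → B ≈A A
  ≈A-sym (arr i d) = arr (≈I-sym i) (≈D-sym d)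

  ≈I-sym : ∀ {A B} → A ≈I B → B ≈I A
  ≈I-sym (perm p) = perm (Perm≈qA-sym p)

  Perm≈qA-sym : ∀ {A B} → Perm _≈qA_ A B → Perm _≈qA_ B A
  Perm≈qA-sym nil = nil
  Perm≈qA-sym (cons (el x) p) = cons (el (≈A-sym x)) (Perm≈qA-sym p)
  Perm≈qA-sym swap = swap
  Perm≈qA-sym (trans p q) = trans (Perm≈qA-sym q) (Perm≈qA-sym p)

  ≈D-sym : ∀ {A B} → A ≈D B → B ≈D A
  ≈D-sym (perm p) = perm (Perm≈pI-sym p)

  Perm≈pI-sym : ∀ {A B} → Perm _≈pI_ A B → Perm _≈pI_ B A
  Perm≈pI-sym nil = nil
  Perm≈pI-sym (cons (el x) p) = cons (el (≈I-sym x)) (Perm≈pI-sym p)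
  Perm≈pI-sym swap = swap
  Perm≈pI-sym (trans p q) = trans (Perm≈pI-sym q) (Perm≈pI-sym p)

≈I-trans : ∀ {A B C} → A ≈I B → B ≈I C → A ≈I C
≈I-trans (perm p) (perm q) = perm (trans p q)

≈D-trans : ∀ {A B C} → A ≈D B → B ≈D C → A ≈D C
≈D-trans (perm p) (perm q) = perm (trans p q)

≈A-trans : ∀ {A B C} → A ≈A B → B ≈A C → A ≈A C
≈A-trans (arr i d) (arr i' d') = arr (≈I-trans i i') (≈D-trans d d')

≈pI-trans : ∀ {x y z} → x ≈pI y → y ≈pI z → x ≈pI z
≈pI-trans (el i) (el j) = el (≈I-trans i j)

≡⇒≈I : ∀ {A B} → A ≡ B → A ≈I B
≡⇒≈I {A} refl = ≈I-refl A

≡⇒≈D : ∀ {A B} → A ≡ B → A ≈D B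
≡⇒≈D {A} refl = ≈D-refl A

++-congI : ∀ {a a' b b'} → a ≈I a' → b ≈I b' → (a ++ b) ≈I (a' ++ b')
++-congI (perm p) (perm q) = perm (Perm-++ ≈qA-refl p q)

++-congD : ∀ {a a' b b'} → a ≈D a' → b ≈D b' → (a ++ b) ≈D (a' ++ b')
++-congD (perm p) (perm q) = perm (Perm-++ ≈pI-refl p q)

++-commI : ∀ a b → (a ++ b) ≈I (b ++ a)
++-commI a b = perm (Perm-++-comm ≈qA-refl a b)

++-commD : ∀ a b → (a ++ b) ≈D (b ++ a)
++-commD a b = perm (Perm-++-comm ≈pI-refl a b)

++-swapD : ∀ a b c → (a ++ (b ++ c)) ≈D (b ++ (a ++ c))
++-swapD a b c = ≈D-trans (≡⇒≈D (sym (LP.++-assoc a b c)))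
  (≈D-trans (++-congD (++-commD a b) (≈D-refl c)) (≡⇒≈D (LP.++-assoc b a c)))

scaleI-cong : ∀ u {a b} → a ≈I b → scaleI u a ≈I scaleI u b
scaleI-cong u (perm p) = perm (Perm-map _ (λ { (el x) → el x }) p)

≈C-refl : ∀ {n} (Γ : Ctx n) → Γ ≈C Γ
≈C-refl [] = tt
≈C-refl (𝓜 ∷ Γ) = ≈I-refl 𝓜 , ≈C-refl Γ

≈C-sym : ∀ {n} {Γ Δ : Ctx n} → Γ ≈C Δ → Δ ≈C Γ
≈C-sym {Γ = []} {[]} e = tt
≈C-sym {Γ = _ ∷ _} {_ ∷ _} (i , e) = ≈I-sym i , ≈C-sym e

≈C-trans : ∀ {n} {Γ Δ Θ : Ctx n} → Γ ≈C Δ → Δ ≈C Θ → Γ ≈C Θ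
≈C-trans {Γ = []} {[]} {[]} e f = tt
≈C-trans {Γ = _ ∷ _} {_ ∷ _} {_ ∷ _} (i , e) (j , f) = ≈I-trans i j , ≈C-trans e f

≡⇒≈C : ∀ {n} {Γ Δ : Ctx n} → Γ ≡ Δ → Γ ≈C Δ
≡⇒≈C {Γ = Γ} refl = ≈C-refl Γ

⊎C-cong : ∀ {n} {Γ Γ' Δ Δ' : Ctx n} → Γ ≈C Γ' → Δ ≈C Δ' → (Γ ⊎C Δ) ≈C (Γ' ⊎C Δ')
⊎C-cong {Γ = []} {[]} {[]} {[]} e f = tt
⊎C-cong {Γ = _ ∷ _} {_ ∷ _} {_ ∷ _} {_ ∷ _} (i , e) (j , f) = ++-congI i j , ⊎C-cong e f

⊎C-comm : ∀ {n} (Γ Δ : Ctx n) → (Γ ⊎C Δ) ≈C (Δ ⊎C Γ)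
⊎C-comm [] [] = tt
⊎C-comm (a ∷ Γ) (b ∷ Δ) = ++-commI a b , ⊎C-comm Γ Δ

⊎C-assoc : ∀ {n} (Γ Δ Θ : Ctx n) → ((Γ ⊎C Δ) ⊎C Θ) ≡ (Γ ⊎C (Δ ⊎C Θ))
⊎C-assoc [] [] [] = refl
⊎C-assoc (a ∷ Γ) (b ∷ Δ) (c ∷ Θ) = cong₂ _∷_ (LP.++-assoc a b c) (⊎C-assoc Γ Δ Θ)

⊎C-identityˡ : ∀ {n} (Γ : Ctx n) → (∅ ⊎C Γ) ≡ Γ
⊎C-identityˡ [] = refl
⊎C-identityˡ (a ∷ Γ) = cong (a ∷_) (⊎C-identityˡ Γ)

⊎C-identityʳ : ∀ {n} (Γ : Ctx n) → (Γ ⊎C ∅) ≡ Γ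
⊎C-identityʳ [] = refl
⊎C-identityʳ (a ∷ Γ) = cong₂ _∷_ (LP.++-identityʳ a) (⊎C-identityʳ Γ)

scaleC-cong : ∀ {n} u {Γ Δ : Ctx n} → Γ ≈C Δ → scaleC u Γ ≈C scaleC u Δ
scaleC-cong u {[]} {[]} e = tt
scaleC-cong u {_ ∷ _} {_ ∷ _} (i , e) = scaleI-cong u i , scaleC-cong u e

scaleC-⊎C : ∀ {n} u (Γ Δ : Ctx n) → scaleC u (Γ ⊎C Δ) ≡ (scaleC u Γ ⊎C scaleC u Δ)
scaleC-⊎C u [] [] = refl
scaleC-⊎C u (a ∷ Γ) (b ∷ Δ) = cong₂ _∷_ (LP.map-++ _ a b) (scaleC-⊎C u Γ Δ)

scaleC-∅ : ∀ {n} u → scaleC {n} u ∅ ≡ ∅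
scaleC-∅ {zero} u = refl
scaleC-∅ {suc n} u = cong ([] ∷_) (scaleC-∅ u)

scaleI-scaleI : ∀ u v (a : Inter) → scaleI u (scaleI v a) ≡ scaleI (u * v) a
scaleI-scaleI u v [] = refl
scaleI-scaleI u v ((q , A) ∷ a) = cong₂ _∷_ (cong (_, A) (sym (QP.*-assoc u v q))) (scaleI-scaleI u v a)

scaleD-scaleD : ∀ u v (a : Dist) → scaleD u (scaleD v a) ≡ scaleD (u * v) a
scaleD-scaleD u v [] = refl
scaleD-scaleD u v ((q , A) ∷ a) = cong₂ _∷_ (cong (_, A) (sym (QP.*-assoc u v q))) (scaleD-scaleD u v a)

scaleC-scaleC : ∀ {n} u v (Γ : Ctx n) → scaleC u (scaleC v Γ) ≡ scaleC (u * v) Γ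
scaleC-scaleC u v [] = refl
scaleC-scaleC u v (a ∷ Γ) = cong₂ _∷_ (scaleI-scaleI u v a) (scaleC-scaleC u v Γ)

⊎C-interchange : ∀ {n} (A B C D : Ctx n) → ((A ⊎C B) ⊎C (C ⊎C D)) ≈C ((A ⊎C C) ⊎C (B ⊎C D))
⊎C-interchange A B C D =
  ≈C-trans (≡⇒≈C (⊎C-assoc A B (C ⊎C D)))
  (≈C-trans (⊎C-cong (≈C-refl A) (≡⇒≈C (sym (⊎C-assoc B C D))))
  (≈C-trans (⊎C-cong (≈C-refl A) (⊎C-cong (⊎C-comm B C) (≈C-refl D)))
  (≈C-trans (⊎C-cong (≈C-refl A) (≡⇒≈C (⊎C-assoc C B D)))
  (≡⇒≈C (sym (⊎C-assoc A C (B ⊎C D)))))))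

single-cong : ∀ {n} (x : Fin n) {a b} → a ≈I b → single x a ≈C single x b
single-cong zero i = i , ≈C-refl ∅
single-cong (suc x) i = ≈I-refl [] , single-cong x i

single-++ : ∀ {n} (x : Fin n) a b → single x (a ++ b) ≡ (single x a ⊎C single x b)
single-++ zero a b = cong ((a ++ b) ∷_) (sym (⊎C-identityˡ ∅))
single-++ (suc x) a b = cong ([] ∷_) (single-++ x a b)

single-scale : ∀ {n} (x : Fin n) u a → single x (scaleI u a) ≡ scaleC u (single x a)
single-scale zero u a = cong (scaleI u a ∷_) (sym (scaleC-∅ u))
single-scale (suc x) u a = cong ([] ∷_) (single-scale x u a)

single-[] : ∀ {n} (x : Fin n) → single x [] ≡ ∅
single-[] zero = refl
single-[] (suc x) = cong ([] ∷_) (single-[] x)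

-- The rules of Defs, indexed by the number of (λ), (@), (⊕) and (let) nodes.
-- The well-formedness side conditions of (Var) and (!) are dropped: the
-- argument never needs them.
mutual
  data _⊢A[_]_∣_∶_ {n : ℕ} : Ctx n → ℕ → ℚ → Val n → Arrow → Set where
    lamR : ∀ {Γ 𝓜 w s M b} → (𝓜 ∷ Γ) ⊢T[ s ] w ∣ M ∶ b → Γ ⊢A[ suc s ] w + 1ℚ ∣ lam M ∶ (𝓜 ⇒ b)
    convA : ∀ {Γ Γ' w s V A A'} → Γ ⊢A[ s ] w ∣ V ∶ A → Γ ≈C Γ' → A ≈A A' → Γ' ⊢A[ s ] w ∣ V ∶ A'

  data _⊢I[_]_∣_∶_ {n : ℕ} : Ctx n → ℕ → ℚ → Val n → Inter → Set where
    varR : ∀ {x 𝓜} → single x 𝓜 ⊢I[ 0 ] 0ℚ ∣ var x ∶ 𝓜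
    bangR : ∀ {Γ w s V 𝓜} → Bangˢ V Γ w s 𝓜 → Γ ⊢I[ s ] w ∣ V ∶ 𝓜
    convI : ∀ {Γ Γ' w s V 𝓜 𝓜'} → Γ ⊢I[ s ] w ∣ V ∶ 𝓜 → Γ ≈C Γ' → 𝓜 ≈I 𝓜' → Γ' ⊢I[ s ] w ∣ V ∶ 𝓜'

  data Bangˢ {n : ℕ} (V : Val n) : Ctx n → ℚ → ℕ → Inter → Set where
    none : Bangˢ V ∅ 0ℚ 0 []
    more : ∀ {Γ w s A q Γ' w' s' 𝓜} → Γ ⊢A[ s ] w ∣ V ∶ A → Bangˢ V Γ' w' s' 𝓜 →
           Bangˢ V (scaleC q Γ ⊎C Γ') (q * w + w') (s +ℕ s') ((q , A) ∷ 𝓜)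

  data _⊢T[_]_∣_∶_ {n : ℕ} : Ctx n → ℕ → ℚ → Tm n → Dist → Set where
    zeroR : ∀ {M} → ∅ ⊢T[ 0 ] 0ℚ ∣ M ∶ 𝟎
    appR : ∀ {Γ Δ w v s t V W 𝓜 b} → Γ ⊢I[ s ] w ∣ V ∶ ((1ℚ , (𝓜 ⇒ b)) ∷ []) → Δ ⊢I[ t ] v ∣ W ∶ 𝓜 →
           (Γ ⊎C Δ) ⊢T[ suc (s +ℕ t) ] w + v ∣ app V W ∶ b
    plusR : ∀ {Γ Δ w v s t M N a b} → Γ ⊢T[ s ] w ∣ M ∶ a → Δ ⊢T[ t ] v ∣ N ∶ b →
            (scaleC ½ Γ ⊎C scaleC ½ Δ) ⊢T[ suc (s +ℕ t) ] ½ * w + ½ * v + 1ℚ ∣ M ⊕ N ∶ (scaleD ½ a ++ scaleD ½ b)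
    letR : ∀ {Γ Δ v w t s N M K b} → Γ ⊢T[ t ] v ∣ N ∶ K → LetPremˢ M K Δ w s b →
           (Γ ⊎C Δ) ⊢T[ suc (s +ℕ t) ] w + v + 1ℚ ∣ letin N M ∶ b
    valR : ∀ {Γ w s V 𝓜} → Γ ⊢I[ s ] w ∣ V ∶ 𝓜 → Γ ⊢T[ s ] w ∣ val V ∶ ((1ℚ , 𝓜) ∷ [])
    convT : ∀ {Γ Γ' w s M a a'} → Γ ⊢T[ s ] w ∣ M ∶ a → Γ ≈C Γ' → a ≈D a' → Γ' ⊢T[ s ] w ∣ M ∶ a'

  data LetPremˢ {n : ℕ} (M : Tm (suc n)) : Dist → Ctx n → ℚ → ℕ → Dist → Set where
    none : LetPremˢ M [] ∅ 0ℚ 0 []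
    more : ∀ {p 𝓜 K Δ w s b Δ' w' s' b'} → (𝓜 ∷ Δ) ⊢T[ s ] w ∣ M ∶ b → LetPremˢ M K Δ' w' s' b' →
           LetPremˢ M ((p , 𝓜) ∷ K) (scaleC p Δ ⊎C Δ') (p * w + w') (s +ℕ s') (scaleD p b ++ b')


mutual
  sizedA : ∀ {n} {Γ : Ctx n} {w V A} → Γ ⊢A w ∣ V ∶ A → ∃ λ s → Γ ⊢A[ s ] w ∣ V ∶ A
  sizedA (lamR d) = let (s , e) = sizedT d in suc s , lamR e
  sizedA (convA d x y) = let (s , e) = sizedA d in s , convA e x y

  sizedI : ∀ {n} {Γ : Ctx n} {w V 𝓜} → Γ ⊢I w ∣ V ∶ 𝓜 → ∃ λ s → Γ ⊢I[ s ] w ∣ V ∶ 𝓜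
  sizedI (varR _) = 0 , varR
  sizedI (bangR b) = let (s , e) = sizedBang b in s , bangR e
  sizedI (convI d x y) = let (s , e) = sizedI d in s , convI e x y

  sizedBang : ∀ {n} {V : Val n} {Γ w 𝓜} → Bang V Γ w 𝓜 → ∃ λ s → Bangˢ V Γ w s 𝓜
  sizedBang none = 0 , none
  sizedBang (more _ d b) = let (s , e) = sizedA d ; (s' , e') = sizedBang b in s +ℕ s' , more e e'

  sizedT : ∀ {n} {Γ : Ctx n} {w M a} → Γ ⊢T w ∣ M ∶ a → ∃ λ s → Γ ⊢T[ s ] w ∣ M ∶ a
  sizedT zeroR = 0 , zeroR
  sizedT (appR d e) = let (s , d') = sizedI d ; (t , e') = sizedI e in suc (s +ℕ t) , appR d' e'
  sizedT (plusR d e) = let (s , d') = sizedT d ; (t , e') = sizedT e in suc (s +ℕ t) , plusR d' e'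
  sizedT (letR d l) = let (t , d') = sizedT d ; (s , l') = sizedLetPrem l in suc (s +ℕ t) , letR d' l'
  sizedT (valR d) = let (s , d') = sizedI d in s , valR d'
  sizedT (convT d x y) = let (s , d') = sizedT d in s , convT d' x y

  sizedLetPrem : ∀ {n} {M : Tm (suc n)} {K Δ w b} → LetPrem M K Δ w b → ∃ λ s → LetPremˢ M K Δ w s b
  sizedLetPrem none = 0 , none
  sizedLetPrem (more d l) = let (s , d') = sizedT d ; (s' , l') = sizedLetPrem l in s +ℕ s' , more d' l'

thin : ∀ {n} k → Fin (k +ℕ n) → Fin (k +ℕ suc n)
thin zero = suc
thin (suc k) = ext (thin k)

insertEmpty : ∀ {n} k → Ctx (k +ℕ n) → Ctx (k +ℕ suc n)
insertEmpty zero Γ = [] ∷ Γ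
insertEmpty (suc k) (a ∷ Γ) = a ∷ insertEmpty k Γ

insertEmpty-⊎C : ∀ {n} k (Γ Δ : Ctx (k +ℕ n)) → insertEmpty k (Γ ⊎C Δ) ≡ (insertEmpty k Γ ⊎C insertEmpty k Δ)
insertEmpty-⊎C zero Γ Δ = refl
insertEmpty-⊎C (suc k) (a ∷ Γ) (b ∷ Δ) = cong (_ ∷_) (insertEmpty-⊎C k Γ Δ)

insertEmpty-scaleC : ∀ {n} k u (Γ : Ctx (k +ℕ n)) → insertEmpty k (scaleC u Γ) ≡ scaleC u (insertEmpty k Γ)
insertEmpty-scaleC zero u Γ = refl
insertEmpty-scaleC (suc k) u (a ∷ Γ) = cong (_ ∷_) (insertEmpty-scaleC k u Γ)

insertEmpty-∅ : ∀ {n} k → insertEmpty {n} k ∅ ≡ ∅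
insertEmpty-∅ zero = refl
insertEmpty-∅ (suc k) = cong ([] ∷_) (insertEmpty-∅ k)

insertEmpty-cong : ∀ {n} k {Γ Δ : Ctx (k +ℕ n)} → Γ ≈C Δ → insertEmpty k Γ ≈C insertEmpty k Δ
insertEmpty-cong zero e = ≈I-refl [] , e
insertEmpty-cong (suc k) {a ∷ Γ} {b ∷ Δ} (i , e) = i , insertEmpty-cong k e

insertEmpty-single : ∀ {n} k (x : Fin (k +ℕ n)) 𝓜 → insertEmpty k (single x 𝓜) ≡ single (thin k x) 𝓜
insertEmpty-single zero x 𝓜 = refl
insertEmpty-single (suc k) zero 𝓜 = cong (𝓜 ∷_) (insertEmpty-∅ k)
insertEmpty-single (suc k) (suc x) 𝓜 = cong ([] ∷_) (insertEmpty-single k x 𝓜)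

mutual
  weakenA : ∀ {n} k {Γ : Ctx (k +ℕ n)} {w s V A} → Γ ⊢A[ s ] w ∣ V ∶ A → insertEmpty k Γ ⊢A[ s ] w ∣ renV (thin k) V ∶ A
  weakenA k (lamR d) = lamR (weakenT (suc k) d)
  weakenA k (convA d x y) = convA (weakenA k d) (insertEmpty-cong k x) y

  weakenI : ∀ {n} k {Γ : Ctx (k +ℕ n)} {w s V 𝓜} → Γ ⊢I[ s ] w ∣ V ∶ 𝓜 → insertEmpty k Γ ⊢I[ s ] w ∣ renV (thin k) V ∶ 𝓜
  weakenI k (varR {x} {𝓜}) = subst (λ Γ → Γ ⊢I[ _ ] _ ∣ _ ∶ _) (sym (insertEmpty-single k x 𝓜)) varR
  weakenI k (bangR b) = bangR (weakenBang k b)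
  weakenI k (convI d x y) = convI (weakenI k d) (insertEmpty-cong k x) y

  weakenBang : ∀ {n} k {V : Val (k +ℕ n)} {Γ w s 𝓜} → Bangˢ V Γ w s 𝓜 → Bangˢ (renV (thin k) V) (insertEmpty k Γ) w s 𝓜
  weakenBang k {V = V} none = subst (λ Γ → Bangˢ (renV (thin k) V) Γ 0ℚ 0 []) (sym (insertEmpty-∅ k)) none
  weakenBang k (more {Γ = Γ} {q = q} {Γ' = Γ'} d b) =
    subst (λ Θ → Bangˢ _ Θ _ _ _) (sym (≡trans (insertEmpty-⊎C k (scaleC q Γ) Γ') (cong (_⊎C insertEmpty k Γ') (insertEmpty-scaleC k q Γ))))
      (more (weakenA k d) (weakenBang k b))

  weakenT : ∀ {n} k {Γ : Ctx (k +ℕ n)} {w s M a} → Γ ⊢T[ s ] w ∣ M ∶ a → insertEmpty k Γ ⊢T[ s ] w ∣ renT (thin k) M ∶ a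
  weakenT k (zeroR {M}) = subst (λ Γ → Γ ⊢T[ 0 ] 0ℚ ∣ renT (thin k) M ∶ []) (sym (insertEmpty-∅ k)) zeroR
  weakenT k (appR {Γ = Γ} {Δ} d e) = subst (λ Θ → Θ ⊢T[ _ ] _ ∣ _ ∶ _) (sym (insertEmpty-⊎C k Γ Δ)) (appR (weakenI k d) (weakenI k e))
  weakenT k (plusR {Γ = Γ} {Δ} d e) =
    subst (λ Θ → Θ ⊢T[ _ ] _ ∣ _ ∶ _)
      (sym (≡trans (insertEmpty-⊎C k (scaleC ½ Γ) (scaleC ½ Δ)) (cong₂ _⊎C_ (insertEmpty-scaleC k ½ Γ) (insertEmpty-scaleC k ½ Δ))))
      (plusR (weakenT k d) (weakenT k e))
  weakenT k (letR {Γ = Γ} {Δ} d l) = subst (λ Θ → Θ ⊢T[ _ ] _ ∣ _ ∶ _) (sym (insertEmpty-⊎C k Γ Δ)) (letR (weakenT k d) (weakenLetPrem k l))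
  weakenT k (valR d) = valR (weakenI k d)
  weakenT k (convT d x y) = convT (weakenT k d) (insertEmpty-cong k x) y

  weakenLetPrem : ∀ {n} k {M : Tm (suc (k +ℕ n))} {K Γ w s b} → LetPremˢ M K Γ w s b → LetPremˢ (renT (thin (suc k)) M) K (insertEmpty k Γ) w s b
  weakenLetPrem k {M = M} none = subst (λ Γ → LetPremˢ (renT (thin (suc k)) M) [] Γ 0ℚ 0 []) (sym (insertEmpty-∅ k)) none
  weakenLetPrem k (more {p = p} {Δ = Δ} {Δ' = Δ'} d l) =
    subst (λ Θ → LetPremˢ _ _ Θ _ _ _) (sym (≡trans (insertEmpty-⊎C k (scaleC p Δ) Δ') (cong (_⊎C insertEmpty k Δ') (insertEmpty-scaleC k p Δ))))
      (more (weakenT (suc k) d) (weakenLetPrem k l))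


record BangUpTo {n} (V : Val n) (Γ : Ctx n) (w : ℚ) (s : ℕ) (𝓜 : Inter) : Set where
  constructor bangUpTo
  field
    Γ' : Ctx n
    d : Bangˢ V Γ' w s 𝓜
    eC : Γ' ≈C Γ

Bangˢ-perm : ∀ {n} {V : Val n} {Γ w s 𝓜 𝓜'} → Perm _≈qA_ 𝓜 𝓜' → Bangˢ V Γ w s 𝓜 → BangUpTo V Γ w s 𝓜'
Bangˢ-perm nil none = bangUpTo ∅ none (≈C-refl ∅)
Bangˢ-perm (cons (el A≈B) p) (more {Γ = Γ} {q = q} {Γ' = Γ'} d b) with Bangˢ-perm p b
... | bangUpTo Θ b' e = bangUpTo _ (more (convA d (≈C-refl Γ) A≈B) b') (⊎C-cong (≈C-refl (scaleC q Γ)) e)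
Bangˢ-perm {V = V} swap (more {Γ = Γ1} {w1} {s1} {A1} {q1} d1 (more {Γ = Γ2} {w2} {s2} {A2} {q2} {Γ3} {w3} {s3} {𝓜} d2 b)) =
  bangUpTo _ (subst₂ (λ w s → Bangˢ V (scaleC q2 Γ2 ⊎C (scaleC q1 Γ1 ⊎C Γ3)) w s ((q2 , A2) ∷ (q1 , A1) ∷ 𝓜))
             (ℚ+.x∙yz≈y∙xz (q2 * w2) (q1 * w1) w3) (ℕ+.x∙yz≈y∙xz s2 s1 s3) (more d2 (more d1 b)))
    (≈C-trans (≡⇒≈C (sym (⊎C-assoc (scaleC q2 Γ2) (scaleC q1 Γ1) Γ3)))
      (≈C-trans (⊎C-cong (⊎C-comm (scaleC q2 Γ2) (scaleC q1 Γ1)) (≈C-refl Γ3)) (≡⇒≈C (⊎C-assoc (scaleC q1 Γ1) (scaleC q2 Γ2) Γ3))))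
Bangˢ-perm (trans p q) b with Bangˢ-perm p b
... | bangUpTo Θ b' e with Bangˢ-perm q b'
... | bangUpTo Θ' b'' e' = bangUpTo Θ' b'' (≈C-trans e' e)

-- Conversions can be pushed to the leaves: up to context equivalence, a
-- derivation of an intersection type is (Var) or a list of (!) premises in
-- the order of the type.
data InterView {n} : Ctx n → ℚ → ℕ → Val n → Inter → Set where
  var-view : ∀ {x Γ 𝓜} → single x 𝓜 ≈C Γ → InterView Γ 0ℚ 0 (var x) 𝓜
  bang-view : ∀ {Γ w s V 𝓜} → BangUpTo V Γ w s 𝓜 → InterView Γ w s V 𝓜

interView : ∀ {n} {Γ : Ctx n} {w s V 𝓜} → Γ ⊢I[ s ] w ∣ V ∶ 𝓜 → InterView Γ w s V 𝓜
interView {Γ = Γ} varR = var-view (≈C-refl Γ)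
interView {Γ = Γ} (bangR b) = bang-view (bangUpTo Γ b (≈C-refl Γ))
interView (convI d e (perm p)) with interView d
... | var-view {x} e' = var-view (≈C-trans (single-cong x (≈I-sym (perm p))) (≈C-trans e' e))
... | bang-view (bangUpTo Θ b e') with Bangˢ-perm p b
...   | bangUpTo Θ' b' e'' = bang-view (bangUpTo Θ' b' (≈C-trans e'' (≈C-trans e' e)))

record SplitBang {n} (V : Val n) (Γ : Ctx n) (w : ℚ) (s : ℕ) (a b : Inter) : Set where
  constructor splitBang
  field
    {Γ1 Γ2} : Ctx n
    {w1 w2} : ℚ
    {s1 s2} : ℕ
    d1 : Bangˢ V Γ1 w1 s1 a
    d2 : Bangˢ V Γ2 w2 s2 b
    eC : Γ ≈C (Γ1 ⊎C Γ2)
    eW : w ≡ w1 + w2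
    eS : s ≡ s1 +ℕ s2

Bangˢ-split : ∀ {n} {V : Val n} {Γ w s} a {b} → Bangˢ V Γ w s (a ++ b) → SplitBang V Γ w s a b
Bangˢ-split [] d = splitBang none d (≡⇒≈C (sym (⊎C-identityˡ _))) (sym (QP.+-identityˡ _)) refl
Bangˢ-split ((q , A) ∷ a) (more {Γ = Γ} {w} {s} d b) with Bangˢ-split a b
... | splitBang {Γ1} {Γ2} {w1} {w2} {s1} {s2} b1 d2 eC eW eS =
  splitBang (more d b1) d2
    (≈C-trans (⊎C-cong (≈C-refl (scaleC q Γ)) eC) (≡⇒≈C (sym (⊎C-assoc (scaleC q Γ) Γ1 Γ2))))
    (≡trans (cong (q * w +_) eW) (sym (QP.+-assoc (q * w) w1 w2)))
    (≡trans (cong (s +ℕ_) eS) (sym (NP.+-assoc s s1 s2)))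

record SplitI {n} (V : Val n) (Γ : Ctx n) (w : ℚ) (s : ℕ) (a b : Inter) : Set where
  constructor splitI
  field
    {Γ1 Γ2} : Ctx n
    {w1 w2} : ℚ
    {s1 s2} : ℕ
    d1 : Γ1 ⊢I[ s1 ] w1 ∣ V ∶ a
    d2 : Γ2 ⊢I[ s2 ] w2 ∣ V ∶ b
    eC : Γ ≈C (Γ1 ⊎C Γ2)
    eW : w ≡ w1 + w2
    eS : s ≡ s1 +ℕ s2

⊢I-split : ∀ {n} {V : Val n} {Γ w s} a {b} → Γ ⊢I[ s ] w ∣ V ∶ (a ++ b) → SplitI V Γ w s a b
⊢I-split a {b} d with interView d
... | var-view {x} e = splitI varR varR (≈C-trans (≈C-sym e) (≡⇒≈C (single-++ x a b))) (sym (QP.+-identityˡ 0ℚ)) refl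
... | bang-view (bangUpTo Θ bg e) with Bangˢ-split a bg
... | splitBang b1 b2 eC eW eS = splitI (bangR b1) (bangR b2) (≈C-trans (≈C-sym e) eC) eW eS

scaled-weight : ∀ u q w w' → (u * q) * w + u * w' ≡ u * (q * w + w')
scaled-weight = solve 4 (λ u q w w' → (u :* q) :* w :+ u :* w' := u :* (q :* w :+ w')) refl

record UnscaleBang {n} (V : Val n) (Γ : Ctx n) (w : ℚ) (s : ℕ) (u : ℚ) (a : Inter) : Set where
  constructor unscaleBang
  field
    {Γ'} : Ctx n
    {w'} : ℚ
    d : Bangˢ V Γ' w' s a
    eC : Γ ≈C scaleC u Γ'
    eW : w ≡ u * w'

Bangˢ-unscale : ∀ {n} {V : Val n} {Γ w s} u a → Bangˢ V Γ w s (scaleI u a) → UnscaleBang V Γ w s u a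
Bangˢ-unscale u [] none = unscaleBang none (≡⇒≈C (sym (scaleC-∅ u))) (sym (QP.*-zeroʳ u))
Bangˢ-unscale u ((q , A) ∷ a) (more {Γ = Γ} {w} d b) with Bangˢ-unscale u a b
... | unscaleBang {Γ'} {w'} b' eC eW =
  unscaleBang (more {q = q} d b')
    (≈C-trans (⊎C-cong (≡⇒≈C (sym (scaleC-scaleC u q Γ))) eC) (≡⇒≈C (sym (scaleC-⊎C u (scaleC q Γ) Γ'))))
    (≡trans (cong ((u * q) * w +_) eW) (scaled-weight u q w w'))

record UnscaleI {n} (V : Val n) (Γ : Ctx n) (w : ℚ) (s : ℕ) (u : ℚ) (a : Inter) : Set where
  constructor unscaleI
  field
    {Γ'} : Ctx n
    {w'} : ℚ
    d : Γ' ⊢I[ s ] w' ∣ V ∶ a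
    eC : Γ ≈C scaleC u Γ'
    eW : w ≡ u * w'

⊢I-unscale : ∀ {n} {V : Val n} {Γ w s} u a → Γ ⊢I[ s ] w ∣ V ∶ (scaleI u a) → UnscaleI V Γ w s u a
⊢I-unscale u a d with interView d
... | var-view {x} e = unscaleI varR (≈C-trans (≈C-sym e) (≡⇒≈C (single-scale x u a))) (sym (QP.*-zeroʳ u))
... | bang-view (bangUpTo Θ bg e) with Bangˢ-unscale u a bg
... | unscaleBang b' eC eW = unscaleI (bangR b') (≈C-trans (≈C-sym e) eC) eW

record EmptyI {n} (Γ : Ctx n) (w : ℚ) (s : ℕ) : Set where
  constructor emptyI
  field
    eC : Γ ≈C ∅
    eW : w ≡ 0ℚ
    eS : s ≡ 0

⊢I-empty : ∀ {n} {V : Val n} {Γ w s} → Γ ⊢I[ s ] w ∣ V ∶ [] → EmptyI Γ w s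
⊢I-empty d with interView d
... | var-view {x} e = emptyI (≈C-trans (≈C-sym e) (≡⇒≈C (single-[] x))) refl refl
... | bang-view (bangUpTo Θ none e) = emptyI (≈C-sym e) refl refl

-- Substitution

unval : ∀ {n} → Tm n → Val n
unval (val V) = V
unval (app V W) = V
unval (M ⊕ N) = unval M
unval (letin N M) = unval N

-- The substitution performed by _[_] is local to its definition; σ₀ recovers
-- it, so that M [ V ] is definitionally subT (substAt zero V) M.
σ₀ : ∀ {n} → Val n → Fin (suc n) → Val n
σ₀ V x = unval (_[_] (val (var x)) V)

substAt : ∀ {n} k → Val n → Fin (k +ℕ suc n) → Val (k +ℕ n)
substAt zero V = σ₀ V
substAt (suc k) V = exts (substAt k V)

lookupAt : ∀ {n} k → Ctx (k +ℕ suc n) → Inter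
lookupAt zero (a ∷ Γ) = a
lookupAt (suc k) (a ∷ Γ) = lookupAt k Γ

removeAt : ∀ {n} k → Ctx (k +ℕ suc n) → Ctx (k +ℕ n)
removeAt zero (a ∷ Γ) = Γ
removeAt (suc k) (a ∷ Γ) = a ∷ removeAt k Γ

padAt : ∀ {n} k → Ctx n → Ctx (k +ℕ n)
padAt zero Δ = Δ
padAt (suc k) Δ = [] ∷ padAt k Δ

lookupAt-⊎C : ∀ {n} k (Γ Δ : Ctx (k +ℕ suc n)) → lookupAt k (Γ ⊎C Δ) ≡ lookupAt k Γ ++ lookupAt k Δ
lookupAt-⊎C zero (a ∷ Γ) (b ∷ Δ) = refl
lookupAt-⊎C (suc k) (a ∷ Γ) (b ∷ Δ) = lookupAt-⊎C k Γ Δ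

lookupAt-scaleC : ∀ {n} k u (Γ : Ctx (k +ℕ suc n)) → lookupAt k (scaleC u Γ) ≡ scaleI u (lookupAt k Γ)
lookupAt-scaleC zero u (a ∷ Γ) = refl
lookupAt-scaleC (suc k) u (a ∷ Γ) = lookupAt-scaleC k u Γ

lookupAt-∅ : ∀ {n} k → lookupAt {n} k ∅ ≡ []
lookupAt-∅ zero = refl
lookupAt-∅ (suc k) = lookupAt-∅ k

lookupAt-cong : ∀ {n} k {Γ Δ : Ctx (k +ℕ suc n)} → Γ ≈C Δ → lookupAt k Γ ≈I lookupAt k Δ
lookupAt-cong zero {a ∷ Γ} {b ∷ Δ} (i , e) = i
lookupAt-cong (suc k) {a ∷ Γ} {b ∷ Δ} (i , e) = lookupAt-cong k e

removeAt-⊎C : ∀ {n} k (Γ Δ : Ctx (k +ℕ suc n)) → removeAt k (Γ ⊎C Δ) ≡ (removeAt k Γ ⊎C removeAt k Δ)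
removeAt-⊎C zero (a ∷ Γ) (b ∷ Δ) = refl
removeAt-⊎C (suc k) (a ∷ Γ) (b ∷ Δ) = cong (_ ∷_) (removeAt-⊎C k Γ Δ)

removeAt-scaleC : ∀ {n} k u (Γ : Ctx (k +ℕ suc n)) → removeAt k (scaleC u Γ) ≡ scaleC u (removeAt k Γ)
removeAt-scaleC zero u (a ∷ Γ) = refl
removeAt-scaleC (suc k) u (a ∷ Γ) = cong (_ ∷_) (removeAt-scaleC k u Γ)

removeAt-∅ : ∀ {n} k → removeAt {n} k ∅ ≡ ∅
removeAt-∅ zero = refl
removeAt-∅ (suc k) = cong ([] ∷_) (removeAt-∅ k)

removeAt-cong : ∀ {n} k {Γ Δ : Ctx (k +ℕ suc n)} → Γ ≈C Δ → removeAt k Γ ≈C removeAt k Δ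
removeAt-cong zero {a ∷ Γ} {b ∷ Δ} (i , e) = e
removeAt-cong (suc k) {a ∷ Γ} {b ∷ Δ} (i , e) = i , removeAt-cong k e

padAt-⊎C : ∀ {n} k (Γ Δ : Ctx n) → padAt k (Γ ⊎C Δ) ≡ (padAt k Γ ⊎C padAt k Δ)
padAt-⊎C zero Γ Δ = refl
padAt-⊎C (suc k) Γ Δ = cong ([] ∷_) (padAt-⊎C k Γ Δ)

padAt-scaleC : ∀ {n} k u (Γ : Ctx n) → padAt k (scaleC u Γ) ≡ scaleC u (padAt k Γ)
padAt-scaleC zero u Γ = refl
padAt-scaleC (suc k) u Γ = cong ([] ∷_) (padAt-scaleC k u Γ)

padAt-∅ : ∀ {n} k → padAt {n} k ∅ ≡ ∅
padAt-∅ zero = refl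
padAt-∅ (suc k) = cong ([] ∷_) (padAt-∅ k)

padAt-cong : ∀ {n} k {Γ Δ : Ctx n} → Γ ≈C Δ → padAt k Γ ≈C padAt k Δ
padAt-cong zero e = e
padAt-cong (suc k) e = ≈I-refl [] , padAt-cong k e

substCtx : ∀ {n} k → Ctx (k +ℕ suc n) → Ctx n → Ctx (k +ℕ n)
substCtx k Γ Δ = removeAt k Γ ⊎C padAt k Δ

substCtx-cong : ∀ {n} k {Γ Γ' : Ctx (k +ℕ suc n)} {Δ Δ' : Ctx n} → Γ ≈C Γ' → Δ ≈C Δ' → substCtx k Γ Δ ≈C substCtx k Γ' Δ'
substCtx-cong k e f = ⊎C-cong (removeAt-cong k e) (padAt-cong k f)

substCtx-⊎C : ∀ {n} k (Γ1 Γ2 : Ctx (k +ℕ suc n)) {Δ Δ1 Δ2 : Ctx n} → Δ ≈C (Δ1 ⊎C Δ2) →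
          substCtx k (Γ1 ⊎C Γ2) Δ ≈C (substCtx k Γ1 Δ1 ⊎C substCtx k Γ2 Δ2)
substCtx-⊎C k Γ1 Γ2 {Δ} {Δ1} {Δ2} e =
  ≈C-trans (⊎C-cong (≡⇒≈C (removeAt-⊎C k Γ1 Γ2)) (≈C-trans (padAt-cong k e) (≡⇒≈C (padAt-⊎C k Δ1 Δ2))))
    (⊎C-interchange (removeAt k Γ1) (removeAt k Γ2) (padAt k Δ1) (padAt k Δ2))

substCtx-scaleC : ∀ {n} k u (Γ : Ctx (k +ℕ suc n)) {Δ Δ' : Ctx n} → Δ ≈C scaleC u Δ' →
          substCtx k (scaleC u Γ) Δ ≈C scaleC u (substCtx k Γ Δ')
substCtx-scaleC k u Γ {Δ} {Δ'} e =
  ≈C-trans (⊎C-cong (≡⇒≈C (removeAt-scaleC k u Γ)) (≈C-trans (padAt-cong k e) (≡⇒≈C (padAt-scaleC k u Δ'))))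
    (≡⇒≈C (sym (scaleC-⊎C u (removeAt k Γ) (padAt k Δ'))))

substCtx-∅ : ∀ {n} k (Γ : Ctx (k +ℕ suc n)) {Δ : Ctx n} → Δ ≈C ∅ → substCtx k Γ Δ ≈C removeAt k Γ
substCtx-∅ k Γ e = ≈C-trans (⊎C-cong (≈C-refl (removeAt k Γ)) (≈C-trans (padAt-cong k e) (≡⇒≈C (padAt-∅ k)))) (≡⇒≈C (⊎C-identityʳ _))

castT : ∀ {n} {Γ Γ' : Ctx n} {w w' s s' M a} → Γ ≈C Γ' → w ≡ w' → s ≡ s' → Γ ⊢T[ s ] w ∣ M ∶ a → Γ' ⊢T[ s' ] w' ∣ M ∶ a
castT {a = a} e refl refl d = convT d e (≈D-refl a)

castI : ∀ {n} {Γ Γ' : Ctx n} {w w' s s' V a} → Γ ≈C Γ' → w ≡ w' → s ≡ s' → Γ ⊢I[ s ] w ∣ V ∶ a → Γ' ⊢I[ s' ] w' ∣ V ∶ a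
castI {a = a} e refl refl d = convI d e (≈I-refl a)

castA : ∀ {n} {Γ Γ' : Ctx n} {w w' s s' V a} → Γ ≈C Γ' → w ≡ w' → s ≡ s' → Γ ⊢A[ s ] w ∣ V ∶ a → Γ' ⊢A[ s' ] w' ∣ V ∶ a
castA {a = a} e refl refl d = convA d e (≈A-refl a)

castB : ∀ {n} {V : Val n} {Γ Γ' w w' s s' a} → BangUpTo V Γ w s a → Γ ≈C Γ' → w ≡ w' → s ≡ s' → BangUpTo V Γ' w' s' a
castB (bangUpTo Θ d e) f refl refl = bangUpTo Θ d (≈C-trans e f)

record LetPremUpTo {n} (M : Tm (suc n)) (K : Dist) (Γ : Ctx n) (w : ℚ) (s : ℕ) (b : Dist) : Set where
  constructor letPremUpTo
  field
    Γ' : Ctx n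
    d : LetPremˢ M K Γ' w s b
    eC : Γ' ≈C Γ

castL : ∀ {n} {M : Tm (suc n)} {K Γ Γ' w w' s s' b} → LetPremUpTo M K Γ w s b → Γ ≈C Γ' → w ≡ w' → s ≡ s' → LetPremUpTo M K Γ' w' s' b
castL (letPremUpTo Θ d e) f refl refl = letPremUpTo Θ d (≈C-trans e f)

retypeI : ∀ {n} {Δ : Ctx n} {v t V a b} → a ≡ b → Δ ⊢I[ t ] v ∣ V ∶ a → Δ ⊢I[ t ] v ∣ V ∶ b
retypeI refl d = d

weight-lam : ∀ w v → (w + v) + 1ℚ ≡ (w + 1ℚ) + v
weight-lam = solve 2 (λ w v → (w :+ v) :+ con 1ℚ := (w :+ con 1ℚ) :+ v) refl

weight-plus : ∀ h w1 w2 v1 v2 → h * (w1 + v1) + h * (w2 + v2) + 1ℚ ≡ (h * w1 + h * w2 + 1ℚ) + (h * v1 + h * v2)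
weight-plus = solve 5 (λ h w1 w2 v1 v2 → h :* (w1 :+ v1) :+ h :* (w2 :+ v2) :+ con 1ℚ := (h :* w1 :+ h :* w2 :+ con 1ℚ) :+ (h :* v1 :+ h :* v2)) refl

weight-let : ∀ wL vL w1 v1 → (wL + vL) + (w1 + v1) + 1ℚ ≡ (wL + w1 + 1ℚ) + (v1 + vL)
weight-let = solve 4 (λ wL vL w1 v1 → (wL :+ vL) :+ (w1 :+ v1) :+ con 1ℚ := (wL :+ w1 :+ con 1ℚ) :+ (v1 :+ vL)) refl

weight-more : ∀ q wa va wr vr → q * (wa + va) + (wr + vr) ≡ (q * wa + wr) + (q * va + vr)
weight-more = solve 5 (λ q wa va wr vr → q :* (wa :+ va) :+ (wr :+ vr) := (q :* wa :+ wr) :+ (q :* va :+ vr)) refl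

size-let : ∀ sL tL s1 t1 → (sL +ℕ tL) +ℕ (s1 +ℕ t1) ≡ (sL +ℕ s1) +ℕ (t1 +ℕ tL)
size-let sL tL s1 t1 = ≡trans (ℕ+.interchange sL tL s1 t1) (cong ((sL +ℕ s1) +ℕ_) (NP.+-comm tL t1))

substVar : ∀ {n} k (x : Fin (k +ℕ suc n)) 𝓝 {V : Val n} {Δ v t} → Δ ⊢I[ t ] v ∣ V ∶ lookupAt k (single x 𝓝) →
         (substCtx k (single x 𝓝) Δ) ⊢I[ 0 +ℕ t ] 0ℚ + v ∣ substAt k V x ∶ 𝓝
substVar zero zero 𝓝 dV = castI (≡⇒≈C (sym (⊎C-identityˡ _))) (sym (QP.+-identityˡ _)) refl dV
substVar zero (suc y) 𝓝 dV with ⊢I-empty dV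
... | emptyI eC refl refl = castI (≈C-sym (substCtx-∅ zero (single (suc y) 𝓝) eC)) (sym (QP.+-identityˡ 0ℚ)) refl varR
substVar (suc k) zero 𝓝 dV with ⊢I-empty (retypeI (lookupAt-∅ k) dV)
... | emptyI eC refl refl =
  castI (≈C-sym (≈C-trans (substCtx-∅ (suc k) (𝓝 ∷ ∅) eC) (≡⇒≈C (cong (𝓝 ∷_) (removeAt-∅ k))))) (sym (QP.+-identityˡ 0ℚ)) refl varR
substVar (suc k) (suc y) 𝓝 dV = weakenI zero (substVar k y 𝓝 dV)

-- The derivation of V is distributed over the occurrences of the variable:
-- split along ⊎C by ⊢I-split and unscaled along scaleC by ⊢I-unscale.
mutual
  substA : ∀ {n} k {Γ : Ctx (k +ℕ suc n)} {w s W A} → Γ ⊢A[ s ] w ∣ W ∶ A → ∀ {V : Val n} {Δ v t} →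
         Δ ⊢I[ t ] v ∣ V ∶ lookupAt k Γ → substCtx k Γ Δ ⊢A[ s +ℕ t ] w + v ∣ subV (substAt k V) W ∶ A
  substA k (lamR {Γ = Γ} {𝓜} {w} d) {Δ = Δ} {v} dV =
    castA (≈C-refl _) (weight-lam w v) refl
      (lamR (convT (substT (suc k) d dV) (≡⇒≈I (LP.++-identityʳ 𝓜) , ≈C-refl (substCtx k Γ Δ)) (≈D-refl _)))
  substA k (convA d e x) dV = convA (substA k d (convI dV (≈C-refl _) (≈I-sym (lookupAt-cong k e)))) (substCtx-cong k e (≈C-refl _)) x

  substI : ∀ {n} k {Γ : Ctx (k +ℕ suc n)} {w s W 𝓝} → Γ ⊢I[ s ] w ∣ W ∶ 𝓝 → ∀ {V : Val n} {Δ v t} →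
         Δ ⊢I[ t ] v ∣ V ∶ lookupAt k Γ → substCtx k Γ Δ ⊢I[ s +ℕ t ] w + v ∣ subV (substAt k V) W ∶ 𝓝
  substI k (varR {x} {𝓝}) dV = substVar k x 𝓝 dV
  substI k (bangR b) dV with substBang k b dV
  ... | bangUpTo Θ b' e = convI (bangR b') e (≈I-refl _)
  substI k (convI d e x) dV = convI (substI k d (convI dV (≈C-refl _) (≈I-sym (lookupAt-cong k e)))) (substCtx-cong k e (≈C-refl _)) x

  substBang : ∀ {n} k {W : Val (k +ℕ suc n)} {Γ w s 𝓝} → Bangˢ W Γ w s 𝓝 → ∀ {V : Val n} {Δ v t} →
         Δ ⊢I[ t ] v ∣ V ∶ lookupAt k Γ → BangUpTo (subV (substAt k V) W) (substCtx k Γ Δ) (w + v) (s +ℕ t) 𝓝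
  substBang k none dV with ⊢I-empty (retypeI (lookupAt-∅ k) dV)
  ... | emptyI eC refl refl =
    castB (bangUpTo ∅ none (≈C-refl ∅)) (≈C-sym (≈C-trans (substCtx-∅ k ∅ eC) (≡⇒≈C (removeAt-∅ k)))) (sym (QP.+-identityˡ 0ℚ)) refl
  substBang k (more {Γ = Γa} {wa} {sa} {A} {q} {Γr} {wr} {sr} d b) {Δ = Δ} {v} {t} dV
    with ⊢I-split (lookupAt k (scaleC q Γa)) (retypeI (lookupAt-⊎C k (scaleC q Γa) Γr) dV)
  ... | splitI {Δ1} {Δ2} {v1} {v2} {t1} {t2} d1 d2 eC eW eS with ⊢I-unscale q (lookupAt k Γa) (retypeI (lookupAt-scaleC k q Γa) d1)
  ... | unscaleI {Δ1'} {v1'} d1' eC1 eW1 with substBang k b d2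
  ... | bangUpTo Θ b' e =
    castB (bangUpTo _ (more {q = q} (substA k d d1') b') (≈C-refl _))
      (≈C-trans (⊎C-cong (≈C-sym (substCtx-scaleC k q Γa eC1)) e) (≈C-sym (substCtx-⊎C k (scaleC q Γa) Γr eC)))
      (≡trans (weight-more q wa v1' wr v2) (cong (λ z → (q * wa + wr) + z) (sym (≡trans eW (cong (_+ v2) eW1)))))
      (≡trans (ℕ+.interchange sa t1 sr t2) (cong ((sa +ℕ sr) +ℕ_) (sym eS)))

  substT : ∀ {n} k {Γ : Ctx (k +ℕ suc n)} {w s M a} → Γ ⊢T[ s ] w ∣ M ∶ a → ∀ {V : Val n} {Δ v t} →
         Δ ⊢I[ t ] v ∣ V ∶ lookupAt k Γ → substCtx k Γ Δ ⊢T[ s +ℕ t ] w + v ∣ subT (substAt k V) M ∶ a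
  substT k zeroR dV with ⊢I-empty (retypeI (lookupAt-∅ k) dV)
  ... | emptyI eC refl refl =
    castT (≈C-sym (≈C-trans (substCtx-∅ k ∅ eC) (≡⇒≈C (removeAt-∅ k)))) (sym (QP.+-identityˡ 0ℚ)) refl zeroR
  substT k (appR {Γ1} {Γ2} {w1} {w2} {s1} {s2} d1 d2) dV
    with ⊢I-split (lookupAt k Γ1) (retypeI (lookupAt-⊎C k Γ1 Γ2) dV)
  ... | splitI {Δ1} {Δ2} {v1} {v2} {t1} {t2} e1 e2 eC eW eS =
    castT (≈C-sym (substCtx-⊎C k Γ1 Γ2 eC))
      (≡trans (ℚ+.interchange w1 v1 w2 v2) (cong ((w1 + w2) +_) (sym eW)))
      (cong suc (≡trans (ℕ+.interchange s1 t1 s2 t2) (cong ((s1 +ℕ s2) +ℕ_) (sym eS))))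
      (appR (substI k d1 e1) (substI k d2 e2))
  substT k (plusR {Γ1} {Γ2} {w1} {w2} {s1} {s2} d1 d2) dV
    with ⊢I-split (lookupAt k (scaleC ½ Γ1)) (retypeI (lookupAt-⊎C k (scaleC ½ Γ1) (scaleC ½ Γ2)) dV)
  ... | splitI {Δ1} {Δ2} {v1} {v2} {t1} {t2} e1 e2 eC eW eS
    with ⊢I-unscale ½ (lookupAt k Γ1) (retypeI (lookupAt-scaleC k ½ Γ1) e1) | ⊢I-unscale ½ (lookupAt k Γ2) (retypeI (lookupAt-scaleC k ½ Γ2) e2)
  ... | unscaleI {Δ1'} {v1'} e1' eC1 eW1 | unscaleI {Δ2'} {v2'} e2' eC2 eW2 =
    castT (≈C-sym (≈C-trans (substCtx-⊎C k (scaleC ½ Γ1) (scaleC ½ Γ2) eC) (⊎C-cong (substCtx-scaleC k ½ Γ1 eC1) (substCtx-scaleC k ½ Γ2 eC2))))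
      (≡trans (weight-plus ½ w1 w2 v1' v2') (cong ((½ * w1 + ½ * w2 + 1ℚ) +_) (sym (≡trans eW (cong₂ _+_ eW1 eW2)))))
      (cong suc (≡trans (ℕ+.interchange s1 t1 s2 t2) (cong ((s1 +ℕ s2) +ℕ_) (sym eS))))
      (plusR (substT k d1 e1') (substT k d2 e2'))
  substT k (letR {Γ1} {ΓL} {w1} {wL} {s1} {sL} d l) dV
    with ⊢I-split (lookupAt k Γ1) (retypeI (lookupAt-⊎C k Γ1 ΓL) dV)
  ... | splitI {Δ1} {ΔL} {v1} {vL} {t1} {tL} e1 eL eC eW eS with substLetPrem k l eL
  ... | letPremUpTo Θ l' e =
    castT (≈C-trans (⊎C-cong (≈C-refl _) e) (≈C-sym (substCtx-⊎C k Γ1 ΓL eC)))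
      (≡trans (weight-let wL vL w1 v1) (cong ((wL + w1 + 1ℚ) +_) (sym eW)))
      (cong suc (≡trans (size-let sL tL s1 t1) (cong ((sL +ℕ s1) +ℕ_) (sym eS))))
      (letR (substT k d e1) l')
  substT k (valR d) dV = valR (substI k d dV)
  substT k (convT d e x) dV = convT (substT k d (convI dV (≈C-refl _) (≈I-sym (lookupAt-cong k e)))) (substCtx-cong k e (≈C-refl _)) x

  substLetPrem : ∀ {n} k {M : Tm (suc (k +ℕ suc n))} {K Γ w s b} → LetPremˢ M K Γ w s b → ∀ {V : Val n} {Δ v t} →
         Δ ⊢I[ t ] v ∣ V ∶ lookupAt k Γ → LetPremUpTo (subT (substAt (suc k) V) M) K (substCtx k Γ Δ) (w + v) (s +ℕ t) b
  substLetPrem k none dV with ⊢I-empty (retypeI (lookupAt-∅ k) dV)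
  ... | emptyI eC refl refl =
    castL (letPremUpTo ∅ none (≈C-refl ∅)) (≈C-sym (≈C-trans (substCtx-∅ k ∅ eC) (≡⇒≈C (removeAt-∅ k)))) (sym (QP.+-identityˡ 0ℚ)) refl
  substLetPrem k (more {p} {𝓜} {K} {Γa} {wa} {sa} {b} {Γr} {wr} {sr} d l) dV
    with ⊢I-split (lookupAt k (scaleC p Γa)) (retypeI (lookupAt-⊎C k (scaleC p Γa) Γr) dV)
  ... | splitI {Δ1} {Δ2} {v1} {v2} {t1} {t2} d1 d2 eC eW eS with ⊢I-unscale p (lookupAt k Γa) (retypeI (lookupAt-scaleC k p Γa) d1)
  ... | unscaleI {Δ1'} {v1'} d1' eC1 eW1 with substLetPrem k l d2
  ... | letPremUpTo Θ l' e =
    castL (letPremUpTo _ (more {p = p} (convT (substT (suc k) d d1') (≡⇒≈I (LP.++-identityʳ 𝓜) , ≈C-refl _) (≈D-refl b)) l') (≈C-refl _))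
      (≈C-trans (⊎C-cong (≈C-sym (substCtx-scaleC k p Γa eC1)) e) (≈C-sym (substCtx-⊎C k (scaleC p Γa) Γr eC)))
      (≡trans (weight-more p wa v1' wr v2) (cong (λ z → (p * wa + wr) + z) (sym (≡trans eW (cong (_+ v2) eW1)))))
      (≡trans (ℕ+.interchange sa t1 sr t2) (cong ((sa +ℕ sr) +ℕ_) (sym eS)))

data AppInv {n} (w : ℚ) (s : ℕ) (U W : Val n) (K : Dist) : Set where
  byZero : w ≡ 0ℚ → s ≡ 0 → [] ≈D K → AppInv w s U W K
  byApp : ∀ {Γ1 Γ2 : Ctx n} {w1 w2 s1 s2 𝓜 b} → Γ1 ⊢I[ s1 ] w1 ∣ U ∶ ((1ℚ , (𝓜 ⇒ b)) ∷ []) → Γ2 ⊢I[ s2 ] w2 ∣ W ∶ 𝓜 →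
         b ≈D K → w ≡ w1 + w2 → s ≡ suc (s1 +ℕ s2) → AppInv w s U W K

invApp : ∀ {n} {Γ : Ctx n} {w s U W K} → Γ ⊢T[ s ] w ∣ app U W ∶ K → AppInv w s U W K
invApp zeroR = byZero refl refl (≈D-refl [])
invApp (appR d1 d2) = byApp d1 d2 (≈D-refl _) refl refl
invApp (convT d e x) with invApp d
... | byZero a b c = byZero a b (≈D-trans c x)
... | byApp d1 d2 c a b = byApp d1 d2 (≈D-trans c x) a b

data PlusInv {n} (w : ℚ) (s : ℕ) (M N : Tm n) (K : Dist) : Set where
  byZero : w ≡ 0ℚ → s ≡ 0 → [] ≈D K → PlusInv w s M N K
  byPlus : ∀ {Γ1 Γ2 : Ctx n} {w1 w2 s1 s2 a b} → Γ1 ⊢T[ s1 ] w1 ∣ M ∶ a → Γ2 ⊢T[ s2 ] w2 ∣ N ∶ b →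
          (scaleD ½ a ++ scaleD ½ b) ≈D K → w ≡ ½ * w1 + ½ * w2 + 1ℚ → s ≡ suc (s1 +ℕ s2) → PlusInv w s M N K

invPlus : ∀ {n} {Γ : Ctx n} {w s M N K} → Γ ⊢T[ s ] w ∣ M ⊕ N ∶ K → PlusInv w s M N K
invPlus zeroR = byZero refl refl (≈D-refl [])
invPlus (plusR d1 d2) = byPlus d1 d2 (≈D-refl _) refl refl
invPlus (convT d e x) with invPlus d
... | byZero a b c = byZero a b (≈D-trans c x)
... | byPlus d1 d2 c a b = byPlus d1 d2 (≈D-trans c x) a b

data LetInv {n} (w : ℚ) (s : ℕ) (N : Tm n) (M : Tm (suc n)) (K : Dist) : Set where
  byZero : w ≡ 0ℚ → s ≡ 0 → [] ≈D K → LetInv w s N M K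
  byLet : ∀ {Γ1 Γ2 : Ctx n} {v wL t sL KN b} → Γ1 ⊢T[ t ] v ∣ N ∶ KN → LetPremˢ M KN Γ2 wL sL b →
         b ≈D K → w ≡ wL + v + 1ℚ → s ≡ suc (sL +ℕ t) → LetInv w s N M K

invLet : ∀ {n} {Γ : Ctx n} {w s N M K} → Γ ⊢T[ s ] w ∣ letin N M ∶ K → LetInv w s N M K
invLet zeroR = byZero refl refl (≈D-refl [])
invLet (letR d l) = byLet d l (≈D-refl _) refl refl
invLet (convT d e x) with invLet d
... | byZero a b c = byZero a b (≈D-trans c x)
... | byLet d1 d2 c a b = byLet d1 d2 (≈D-trans c x) a b

data ValInv {n} (w : ℚ) (s : ℕ) (V : Val n) (K : Dist) : Set where
  byZero : w ≡ 0ℚ → s ≡ 0 → [] ≈D K → ValInv w s V K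
  byVal : ∀ {Γ : Ctx n} {𝓜} → Γ ⊢I[ s ] w ∣ V ∶ 𝓜 → ((1ℚ , 𝓜) ∷ []) ≈D K → ValInv w s V K

invVal : ∀ {n} {Γ : Ctx n} {w s V K} → Γ ⊢T[ s ] w ∣ val V ∶ K → ValInv w s V K
invVal zeroR = byZero refl refl (≈D-refl [])
invVal (valR d) = byVal d (≈D-refl _)
invVal (convT d e x) with invVal d
... | byZero a b c = byZero a b (≈D-trans c x)
... | byVal d c = byVal d (≈D-trans c x)

record LamInv {n} (w : ℚ) (s : ℕ) (M : Tm (suc n)) (A : Arrow) : Set where
  constructor lamInv
  field
    {𝓜} : Inter
    {b} : Dist
    {Γb} : Ctx n
    {wb} : ℚ
    {sb} : ℕ
    body : (𝓜 ∷ Γb) ⊢T[ sb ] wb ∣ M ∶ b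
    eA : (𝓜 ⇒ b) ≈A A
    eW : w ≡ wb + 1ℚ
    eS : s ≡ suc sb

invLam : ∀ {n} {Γ : Ctx n} {w s M A} → Γ ⊢A[ s ] w ∣ lam M ∶ A → LamInv w s M A
invLam (lamR d) = lamInv d (≈A-refl _) refl refl
invLam (convA d e x) with invLam d
... | lamInv body eA eW eS = lamInv body (≈A-trans eA x) eW eS

closedCtx : ∀ {Γ : Ctx 0} {w s M a} → Γ ⊢T[ s ] w ∣ M ∶ a → [] ⊢T[ s ] w ∣ M ∶ a
closedCtx {[]} d = d

record LetPremUpToType {n} (M : Tm (suc n)) (K : Dist) (w : ℚ) (s : ℕ) (b : Dist) : Set where
  constructor letPremUpToType
  field
    {Γ'} : Ctx n
    {b'} : Dist
    d : LetPremˢ M K Γ' w s b'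
    e : b ≈D b'

LetPremˢ-perm : ∀ {n} {M : Tm (suc n)} {K K2 Γ w s b} → Perm _≈pI_ K K2 → LetPremˢ M K Γ w s b → LetPremUpToType M K2 w s b
LetPremˢ-perm nil none = letPremUpToType none (≈D-refl [])
LetPremˢ-perm (cons (el i) p) (more {Δ = Δ} d l) with LetPremˢ-perm p l
... | letPremUpToType l' e = letPremUpToType (more (convT d (i , ≈C-refl Δ) (≈D-refl _)) l') (++-congD (≈D-refl _) e)
LetPremˢ-perm {M = M} swap (more {p1} {𝓜1} {_} {Δ1} {w1} {s1} {b1} d1 (more {p2} {𝓜2} {K} {Δ2} {w2} {s2} {b2} {Δ'} {w'} {s'} {b'} d2 l)) =
  letPremUpToType (subst₂ (λ w s → LetPremˢ M ((p2 , 𝓜2) ∷ (p1 , 𝓜1) ∷ K) (scaleC p2 Δ2 ⊎C (scaleC p1 Δ1 ⊎C Δ')) w s (scaleD p2 b2 ++ (scaleD p1 b1 ++ b')))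
        (ℚ+.x∙yz≈y∙xz (p2 * w2) (p1 * w1) w') (ℕ+.x∙yz≈y∙xz s2 s1 s') (more d2 (more d1 l)))
     (++-swapD (scaleD p1 b1) (scaleD p2 b2) b')
LetPremˢ-perm (trans p q) l with LetPremˢ-perm p l
... | letPremUpToType l1 e1 with LetPremˢ-perm q l1
... | letPremUpToType l2 e2 = letPremUpToType l2 (≈D-trans e1 e2)

record SplitLet {n} (M : Tm (suc n)) (K1 K2 : Dist) (w : ℚ) (s : ℕ) (b : Dist) : Set where
  constructor splitLet
  field
    {Γ1 Γ2} : Ctx n
    {w1 w2} : ℚ
    {s1 s2} : ℕ
    {b1 b2} : Dist
    l1 : LetPremˢ M K1 Γ1 w1 s1 b1
    l2 : LetPremˢ M K2 Γ2 w2 s2 b2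
    eW : w ≡ w1 + w2
    eS : s ≡ s1 +ℕ s2
    eB : b ≡ b1 ++ b2

LetPremˢ-split : ∀ {n} {M : Tm (suc n)} K1 {K2 Γ w s b} → LetPremˢ M (K1 ++ K2) Γ w s b → SplitLet M K1 K2 w s b
LetPremˢ-split [] l = splitLet none l (sym (QP.+-identityˡ _)) refl refl
LetPremˢ-split ((p , 𝓜) ∷ K1) (more {w = w} {s} {b} d l) with LetPremˢ-split K1 l
... | splitLet {w1 = w1} {w2} {s1} {s2} {b1} {b2} l1 l2 eW eS eB =
  splitLet (more d l1) l2 (≡trans (cong (p * w +_) eW) (sym (QP.+-assoc (p * w) w1 w2)))
     (≡trans (cong (s +ℕ_) eS) (sym (NP.+-assoc s s1 s2)))
     (≡trans (cong (scaleD p b ++_) eB) (sym (LP.++-assoc (scaleD p b) b1 b2)))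

record UnscaleLet {n} (M : Tm (suc n)) (K : Dist) (u w : ℚ) (s : ℕ) (b : Dist) : Set where
  constructor unscaleLet
  field
    {Γ'} : Ctx n
    {w'} : ℚ
    {b'} : Dist
    l : LetPremˢ M K Γ' w' s b'
    eW : w ≡ u * w'
    eB : b ≡ scaleD u b'

LetPremˢ-unscale : ∀ {n} {M : Tm (suc n)} u K {Γ w s b} → LetPremˢ M (scaleD u K) Γ w s b → UnscaleLet M K u w s b
LetPremˢ-unscale u [] none = unscaleLet none (sym (QP.*-zeroʳ u)) refl
LetPremˢ-unscale u ((q , 𝓜) ∷ K) (more {w = w} {b = bb} d l) with LetPremˢ-unscale u K l
... | unscaleLet {w' = w'} {b'} l' eW eB =
  unscaleLet (more {p = q} d l') (≡trans (cong ((u * q) * w +_) eW) (scaled-weight u q w w'))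
    (≡trans (cong₂ _++_ (sym (scaleD-scaleD u q bb)) eB) (sym (LP.map-++ _ (scaleD q bb) b')))

0≤1 : 0ℚ ≤ 1ℚ
0≤1 = Dec.toWitness {a? = 0ℚ QP.≤? 1ℚ} tt

0≤½ : 0ℚ ≤ ½
0≤½ = Dec.toWitness {a? = 0ℚ QP.≤? ½} tt

mass : MDist → ℚ
mass [] = 0ℚ
mass ((p , _) ∷ m) = p + mass m

underLet : Tm 1 → MDist → MDist
underLet M = map (λ pN → (proj₁ pN , letin (proj₂ pN) M))

mass-underLet : ∀ M m → mass (underLet M m) ≡ mass m
mass-underLet M [] = refl
mass-underLet M ((p , N) ∷ m) = cong (p +_) (mass-underLet M m)

mass-stepT : ∀ N → mass (stepT N) ≡ 1ℚ
mass-stepT (val V) = refl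
mass-stepT (app (lam M) V) = refl
mass-stepT (M ⊕ N) = refl
mass-stepT (letin (val V) M) = refl
mass-stepT (letin (app V W) M) = ≡trans (mass-underLet M (stepT (app V W))) (mass-stepT (app V W))
mass-stepT (letin (N₁ ⊕ N₂) M) = ≡trans (mass-underLet M (stepT (N₁ ⊕ N₂))) (mass-stepT (N₁ ⊕ N₂))
mass-stepT (letin (letin N₁ N₂) M) = ≡trans (mass-underLet M (stepT (letin N₁ N₂))) (mass-stepT (letin N₁ N₂))

mass-++ : ∀ xs ys → mass (xs ++ ys) ≡ mass xs + mass ys
mass-++ [] ys = sym (QP.+-identityˡ _)
mass-++ ((p , M) ∷ xs) ys = ≡trans (cong (p +_) (mass-++ xs ys)) (sym (QP.+-assoc p (mass xs) (mass ys)))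

mass-scaleMD : ∀ p l → mass (scaleMD p l) ≡ p * mass l
mass-scaleMD p [] = sym (QP.*-zeroʳ p)
mass-scaleMD p ((q , M) ∷ l) = ≡trans (cong (p * q +_) (mass-scaleMD p l)) (sym (QP.*-distribˡ-+ p q (mass l)))

mass-lift : ∀ m → mass (lift m) ≡ mass m
mass-lift [] = refl
mass-lift ((p , M) ∷ m) =
  ≡trans (mass-++ (scaleMD p (stepT M)) (lift m))
    (cong₂ _+_ (≡trans (mass-scaleMD p (stepT M)) (≡trans (cong (p *_) (mass-stepT M)) (QP.*-identityʳ p))) (mass-lift m))

mass-mseq : ∀ M j → mass (mseq M j) ≡ 1ℚ
mass-mseq M zero = refl
mass-mseq M (suc j) = ≡trans (mass-lift (mseq M j)) (mass-mseq M j)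

NonNeg : MDist → Set
NonNeg = All (λ e → 0ℚ ≤ proj₁ e)

nonNeg-underLet : ∀ M {m} → NonNeg m → NonNeg (underLet M m)
nonNeg-underLet M [] = []
nonNeg-underLet M (x ∷ a) = x ∷ nonNeg-underLet M a

nonNeg-stepT : ∀ N → NonNeg (stepT N)
nonNeg-stepT (val V) = 0≤1 ∷ []
nonNeg-stepT (app (lam M) V) = 0≤1 ∷ []
nonNeg-stepT (M ⊕ N) = 0≤½ ∷ 0≤½ ∷ []
nonNeg-stepT (letin (val V) M) = 0≤1 ∷ []
nonNeg-stepT (letin (app V W) M) = nonNeg-underLet M (nonNeg-stepT (app V W))
nonNeg-stepT (letin (N₁ ⊕ N₂) M) = nonNeg-underLet M (nonNeg-stepT (N₁ ⊕ N₂))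
nonNeg-stepT (letin (letin N₁ N₂) M) = nonNeg-underLet M (nonNeg-stepT (letin N₁ N₂))

length-underLet : ∀ M m → length (underLet M m) ≡ length m
length-underLet M = LP.length-map _

length-stepT≤2 : ∀ M → length (stepT M) ≤ℕ 2
length-stepT≤2 (val V) = s≤s z≤n
length-stepT≤2 (app (lam M) V) = s≤s z≤n
length-stepT≤2 (M ⊕ N) = s≤s (s≤s z≤n)
length-stepT≤2 (letin (val V) M) = s≤s z≤n
length-stepT≤2 (letin (app V W) M) = NP.≤-trans (NP.≤-reflexive (length-underLet M (stepT (app V W)))) (length-stepT≤2 (app V W))
length-stepT≤2 (letin (N₁ ⊕ N₂) M) = NP.≤-trans (NP.≤-reflexive (length-underLet M (stepT (N₁ ⊕ N₂)))) (length-stepT≤2 (N₁ ⊕ N₂))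
length-stepT≤2 (letin (letin N₁ N₂) M) = NP.≤-trans (NP.≤-reflexive (length-underLet M (stepT (letin N₁ N₂)))) (length-stepT≤2 (letin N₁ N₂))

-- Subject reduction

data TypedMD : MDist → Dist → ℚ → List ℕ → Set where
  [] : TypedMD [] [] 0ℚ []
  cons : ∀ {p N K w s m K' W ss} → 0ℚ ≤ p → [] ⊢T[ s ] w ∣ N ∶ K → TypedMD m K' W ss →
         TypedMD ((p , N) ∷ m) (scaleD p K ++ K') (p * w + W) (s ∷ ss)

TypedMD-byZero : ∀ m → NonNeg m → Σ (List ℕ) λ ss → All (_≡ 0) ss × TypedMD m [] 0ℚ ss
TypedMD-byZero [] [] = [] , [] , []
TypedMD-byZero ((p , N) ∷ m) (p≥0 ∷ nonNeg) with TypedMD-byZero m nonNeg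
... | ss , zeros , r = 0 ∷ ss , refl ∷ zeros , subst (λ W → TypedMD ((p , N) ∷ m) [] W (0 ∷ ss)) p*0+0≡0 (cons p≥0 zeroR r)
  where
  p*0+0≡0 : p * 0ℚ + 0ℚ ≡ 0ℚ
  p*0+0≡0 = ≡trans (QP.+-identityʳ (p * 0ℚ)) (QP.*-zeroʳ p)

record StepTyping (m : MDist) (v : ℚ) (s : ℕ) (K : Dist) : Set where
  constructor stepTyping
  field
    {K'} : Dist
    {W} : ℚ
    {ss} : List ℕ
    r : TypedMD m K' W ss
    eK : K ≈D K'
    eW : v ≤ 1ℚ + W
    eS : All (_<ℕ s) ss ⊎ (s ≡ 0 × v ≡ 0ℚ × [] ≈D K × All (_≡ 0) ss)

zeroStep : ∀ m {v s K} → NonNeg m → v ≡ 0ℚ → s ≡ 0 → [] ≈D K → StepTyping m v s K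
zeroStep m nonNeg refl refl eK with TypedMD-byZero m nonNeg
... | ss , zeros , r = stepTyping r (≈D-sym eK) 0≤1 (inj₂ (refl , refl , eK , zeros))

data SizeBound (sL : ℕ) : List ℕ → List ℕ → Set where
  [] : SizeBound sL [] []
  _∷_ : ∀ {a c as cs} → a ≤ℕ suc (sL +ℕ c) → SizeBound sL as cs → SizeBound sL (a ∷ as) (c ∷ cs)

SizeBound-mono : ∀ {s s' as cs} → s ≤ℕ s' → SizeBound s as cs → SizeBound s' as cs
SizeBound-mono le [] = []
SizeBound-mono le (x ∷ p) = NP.≤-trans x (s≤s (NP.+-monoˡ-≤ _ le)) ∷ SizeBound-mono le p

SizeBound-< : ∀ {sL t as cs} → SizeBound sL as cs → All (_<ℕ t) cs → All (_<ℕ suc (sL +ℕ t)) as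
SizeBound-< [] [] = []
SizeBound-< {sL} (x ∷ p) (y ∷ a) = NP.≤-<-trans x (s≤s (NP.+-monoʳ-< sL y)) ∷ SizeBound-< p a

record UnderLetTyping (M : Tm 1) (m : MDist) (W : ℚ) (ss : List ℕ) (wL : ℚ) (sL : ℕ) (b : Dist) : Set where
  constructor underLetTyping
  field
    {K'} : Dist
    {W'} : ℚ
    {ss'} : List ℕ
    r : TypedMD (underLet M m) K' W' ss'
    eb : b ≡ K'
    eW : W' ≡ wL + W + mass m
    eS : SizeBound sL ss' ss

-- The (let) rule applied entrywise: the premises for ⊔ᵢ pᵢKᵢ are split into
-- pᵢ-scaled premises for the Kᵢ.
TypedMD-underLet : ∀ {M : Tm 1} {m K W ss Γ wL sL b} → TypedMD m K W ss → LetPremˢ M K Γ wL sL b → UnderLetTyping M m W ss wL sL b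
TypedMD-underLet [] none = underLetTyping [] refl refl []
TypedMD-underLet {M} (cons {p} {N} {Ki} {w} {s} {m} p≥0 d r) l with LetPremˢ-split (scaleD p Ki) l
... | splitLet {w1 = w1} {w2} {s1} {s2} {b1} {b2} l1 l2 eW eS eB with LetPremˢ-unscale p Ki l1
... | unscaleLet {w' = w'} {b'} l1' eW1 eB1 with TypedMD-underLet r l2
... | underLetTyping {W' = W'} r' eb' eW' eS' =
  underLetTyping (cons p≥0 (closedCtx (letR d l1')) r')
    (≡trans eB (cong₂ _++_ eB1 eb'))
    (sym (≡trans (cong₂ (λ a z → a + _ + z) (≡trans eW (cong (_+ w2) eW1)) refl)
      (sym (≡trans (cong (p * (w' + w + 1ℚ) +_) eW') (regroup p w' w w2 _ (mass m))))))
    (s≤s (NP.+-monoˡ-≤ s (≡+⇒≤ˡ eS)) ∷ SizeBound-mono (≡+⇒≤ʳ eS) eS')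
  where
  regroup : ∀ p w' w w2 W mm → p * (w' + w + 1ℚ) + (w2 + W + mm) ≡ (p * w' + w2) + (p * w + W) + (p + mm)
  regroup = solve 6 (λ p w' w w2 W mm → p :* (w' :+ w :+ con 1ℚ) :+ (w2 :+ W :+ mm) := (p :* w' :+ w2) :+ (p :* w :+ W) :+ (p :+ mm)) refl
  ≡+⇒≤ˡ : ∀ {a b c : ℕ} → a ≡ b +ℕ c → b ≤ℕ a
  ≡+⇒≤ˡ {b = b} {c} refl = NP.m≤m+n b c
  ≡+⇒≤ʳ : ∀ {a b c : ℕ} → a ≡ b +ℕ c → c ≤ℕ a
  ≡+⇒≤ʳ {b = b} {c} refl = NP.m≤n+m c b

subjectReduction-let : ∀ (N : Tm 0) (M : Tm 1) {v s K} →
                       (∀ {v s K} → [] ⊢T[ s ] v ∣ N ∶ K → StepTyping (stepT N) v s K) →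
                       [] ⊢T[ s ] v ∣ letin N M ∶ K → StepTyping (underLet M (stepT N)) v s K
subjectReduction-let N M reduceN d with invLet d
... | byZero eW eS eK = zeroStep _ (nonNeg-underLet M (nonNeg-stepT N)) eW eS eK
... | byLet dN l bK refl refl with reduceN (closedCtx dN)
... | stepTyping r eK eW (inj₂ (refl , refl , perm []≈KN , _)) with Perm-[]ˡ []≈KN
... | refl with l
... | none with TypedMD-byZero _ (nonNeg-underLet M (nonNeg-stepT N))
... | _ , zeros , r' = stepTyping r' (≈D-sym bK) QP.≤-refl (inj₁ (All≡0⇒All< zeros))
  where
  All≡0⇒All< : ∀ {n ss} → All (_≡ 0) ss → All (_<ℕ suc n) ss
  All≡0⇒All< [] = []
  All≡0⇒All< (refl ∷ a) = s≤s z≤n ∷ All≡0⇒All< a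
subjectReduction-let N M reduceN d | byLet {v = vN} {wL} dN l bK refl refl
  | stepTyping {W = W} r (perm c) eW (inj₁ below) with LetPremˢ-perm c l
... | letPremUpToType l' e with TypedMD-underLet r l'
... | underLetTyping {W' = W'} r' eb eW' eS' =
  stepTyping r' (≈D-trans (≈D-sym bK) (≈D-trans e (≡⇒≈D eb))) weight (inj₁ (SizeBound-< eS' below))
  where
  open QP.≤-Reasoning
  weight : wL + vN + 1ℚ ≤ 1ℚ + W'
  weight = begin
    wL + vN + 1ℚ                    ≤⟨ QP.+-monoˡ-≤ 1ℚ (QP.+-monoʳ-≤ wL eW) ⟩
    wL + (1ℚ + W) + 1ℚ              ≡⟨ solve 2 (λ wL W → wL :+ (con 1ℚ :+ W) :+ con 1ℚ := con 1ℚ :+ (wL :+ W :+ con 1ℚ)) refl wL W ⟩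
    1ℚ + (wL + W + 1ℚ)              ≡⟨ cong (λ μ → 1ℚ + (wL + W + μ)) (sym (mass-stepT N)) ⟩
    1ℚ + (wL + W + mass (stepT N))  ≡⟨ cong (1ℚ +_) (sym eW') ⟩
    1ℚ + W'                         ∎

data NonValue : Tm 0 → Set where
  nApp : ∀ {V W} → NonValue (app V W)
  nPlus : ∀ {M N} → NonValue (M ⊕ N)
  nLet : ∀ {N M} → NonValue (letin N M)

scaleD-identity : ∀ b → scaleD 1ℚ b ≡ b
scaleD-identity [] = refl
scaleD-identity ((p , 𝓜) ∷ b) = cong₂ _∷_ (cong (_, 𝓜) (QP.*-identityˡ p)) (scaleD-identity b)

subjectReduction : ∀ (N : Tm 0) {v s K} → NonValue N → [] ⊢T[ s ] v ∣ N ∶ K → StepTyping (stepT N) v s K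
subjectReduction (app (var ()) W) nApp d
subjectReduction (app (lam M) V) nApp d with invApp d
... | byZero eW eS eK = zeroStep _ (nonNeg-stepT (app (lam M) V)) eW eS eK
... | byApp {w2 = w2} {s2 = s2} dF dW bK eW eS with interView dF
... | bang-view (bangUpTo Θ (more dA none) e) with invLam dA
... | lamInv {b = b} {wb = wb} {sb = sb} body (arr i bb) refl refl =
  stepTyping (cons 0≤1 (closedCtx (substT 0 body (convI dW (≈C-refl _) (≈I-sym i)))) [])
    (≈D-trans (≈D-sym bK) (≈D-trans (≈D-sym bb) (≡⇒≈D (sym (≡trans (LP.++-identityʳ _) (scaleD-identity b))))))
    (QP.≤-reflexive (≡trans eW (regroup wb w2)))
    (inj₁ (smaller eS ∷ []))
  where
  regroup : ∀ wb w2 → (1ℚ * (wb + 1ℚ) + 0ℚ) + w2 ≡ 1ℚ + (1ℚ * (wb + w2) + 0ℚ)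
  regroup = solve 2 (λ wb w2 → (con 1ℚ :* (wb :+ con 1ℚ) :+ con 0ℚ) :+ w2 := con 1ℚ :+ (con 1ℚ :* (wb :+ w2) :+ con 0ℚ)) refl
  smaller : ∀ {s} → s ≡ suc ((suc sb +ℕ 0) +ℕ s2) → sb +ℕ s2 <ℕ s
  smaller refl = s≤s (NP.+-monoˡ-≤ s2 (NP.≤-trans (NP.n≤1+n sb) (NP.m≤m+n (suc sb) 0)))
subjectReduction (M₁ ⊕ M₂) nPlus d with invPlus d
... | byZero eW eS eK = zeroStep _ (nonNeg-stepT (M₁ ⊕ M₂)) eW eS eK
... | byPlus {w1 = w1} {w2} {s1} {s2} {a} {b} d1 d2 c eW refl =
  stepTyping (cons 0≤½ (closedCtx d1) (cons 0≤½ (closedCtx d2) []))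
    (≈D-trans (≈D-sym c) (≡⇒≈D (cong (scaleD ½ a ++_) (sym (LP.++-identityʳ _)))))
    (QP.≤-reflexive (≡trans eW (regroup ½ w1 w2)))
    (inj₁ (s≤s (NP.m≤m+n s1 s2) ∷ s≤s (NP.m≤n+m s2 s1) ∷ []))
  where
  regroup : ∀ h w1 w2 → h * w1 + h * w2 + 1ℚ ≡ 1ℚ + (h * w1 + (h * w2 + 0ℚ))
  regroup = solve 3 (λ h w1 w2 → h :* w1 :+ h :* w2 :+ con 1ℚ := con 1ℚ :+ (h :* w1 :+ (h :* w2 :+ con 0ℚ))) refl
subjectReduction (letin (val V) M) nLet d with invLet d
... | byZero eW eS eK = zeroStep _ (nonNeg-stepT (letin (val V) M)) eW eS eK
... | byLet {v = vN} {t = tN} dN l bK eW refl with invVal dN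
... | byZero refl refl (perm c) with Perm-[]ˡ c
... | refl with l
... | none = stepTyping (cons 0≤1 zeroR []) (≈D-sym bK) (QP.≤-reflexive eW) (inj₁ (s≤s z≤n ∷ []))
subjectReduction (letin (val V) M) nLet d | byLet {v = vN} {t = tN} dN l bK eW refl | byVal dV (perm c)
  with Perm-[-]ʳ ≈pI-trans (Perm≈pI-sym c)
... | (._ , ._) , refl , el i with l
... | more {w = wB} {s = sB} dB none =
  stepTyping (cons 0≤1 (closedCtx (substT 0 dB (convI dV (≈C-refl _) (≈I-sym i)))) [])
    (≈D-sym bK)
    (QP.≤-reflexive (≡trans eW (regroup wB vN)))
    (inj₁ (s≤s (NP.≤-reflexive (cong (_+ℕ tN) (sym (NP.+-identityʳ sB)))) ∷ []))
  where
  regroup : ∀ wB vN → (1ℚ * wB + 0ℚ) + vN + 1ℚ ≡ 1ℚ + (1ℚ * (wB + vN) + 0ℚ)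
  regroup = solve 2 (λ wB vN → (con 1ℚ :* wB :+ con 0ℚ) :+ vN :+ con 1ℚ := con 1ℚ :+ (con 1ℚ :* (wB :+ vN) :+ con 0ℚ)) refl
subjectReduction (letin (app U W) M) nLet d = subjectReduction-let (app U W) M (subjectReduction (app U W) nApp) d
subjectReduction (letin (N₁ ⊕ N₂) M) nLet d = subjectReduction-let (N₁ ⊕ N₂) M (subjectReduction (N₁ ⊕ N₂) nPlus) d
subjectReduction (letin (letin N₁ N₂) M) nLet d = subjectReduction-let (letin N₁ N₂) M (subjectReduction (letin N₁ N₂) nLet) d

-- TypedMD at type 𝟎; a separate family, since an index scaleD p K ++ K' cannot
-- be matched against [].
data ZeroTypedMD : MDist → ℚ → List ℕ → Set where
  [] : ZeroTypedMD [] 0ℚ []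
  cons : ∀ {p M w s m W ss} → 0ℚ ≤ p → [] ⊢T[ s ] w ∣ M ∶ 𝟎 → ZeroTypedMD m W ss → ZeroTypedMD ((p , M) ∷ m) (p * w + W) (s ∷ ss)

reweigh : ∀ {m W W' ss} → W ≡ W' → ZeroTypedMD m W ss → ZeroTypedMD m W' ss
reweigh refl t = t

TypedMD⇒ZeroTypedMD : ∀ {m K W ss} → TypedMD m K W ss → K ≡ [] → ZeroTypedMD m W ss
TypedMD⇒ZeroTypedMD [] e = []
TypedMD⇒ZeroTypedMD (cons {K = []} p≥0 d r) e = cons p≥0 d (TypedMD⇒ZeroTypedMD r e)

ZeroTypedMD-length : ∀ {m W ss} → ZeroTypedMD m W ss → length ss ≡ length m
ZeroTypedMD-length [] = refl
ZeroTypedMD-length (cons _ _ t) = cong suc (ZeroTypedMD-length t)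

*-nonNeg : ∀ {p q} → 0ℚ ≤ p → 0ℚ ≤ q → 0ℚ ≤ p * q
*-nonNeg {p} {q} p≥0 q≥0 = QP.nonNegative⁻¹ (p * q) {{QP.nonNeg*nonNeg⇒nonNeg p {{nonNegative p≥0}} q {{nonNegative q≥0}}}}

ZeroTypedMD-scale : ∀ p {m W ss} → 0ℚ ≤ p → ZeroTypedMD m W ss → ZeroTypedMD (scaleMD p m) (p * W) ss
ZeroTypedMD-scale p p≥0 [] = reweigh (sym (QP.*-zeroʳ p)) []
ZeroTypedMD-scale p p≥0 (cons {q} {w = w} {W = W} q≥0 d t) =
  reweigh (scaled-weight p q w W) (cons (*-nonNeg p≥0 q≥0) d (ZeroTypedMD-scale p p≥0 t))

ZeroTypedMD-++ : ∀ {m₁ W₁ ss₁ m₂ W₂ ss₂} → ZeroTypedMD m₁ W₁ ss₁ → ZeroTypedMD m₂ W₂ ss₂ →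
                 ZeroTypedMD (m₁ ++ m₂) (W₁ + W₂) (ss₁ ++ ss₂)
ZeroTypedMD-++ [] t₂ = reweigh (sym (QP.+-identityˡ _)) t₂
ZeroTypedMD-++ (cons {p} {w = w} {W = W} p≥0 d t₁) t₂ =
  reweigh (sym (QP.+-assoc (p * w) W _)) (cons p≥0 d (ZeroTypedMD-++ t₁ t₂))

SizesBelow : ℕ → List ℕ → Set
SizesBelow s ss = All (_<ℕ s) ss ⊎ (s ≡ 0 × All (_≡ 0) ss)

nonValueWeight : Tm 0 → ℚ
nonValueWeight (val V) = 0ℚ
nonValueWeight (app V W) = 1ℚ
nonValueWeight (M ⊕ N) = 1ℚ
nonValueWeight (letin N M) = 1ℚ

record EntryStep (M : Tm 0) (w : ℚ) (s : ℕ) : Set where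
  constructor entryStep
  field
    {W} : ℚ
    {ss} : List ℕ
    t : ZeroTypedMD (stepT M) W ss
    eW : w ≤ nonValueWeight M + W
    eS : SizesBelow s ss

StepTyping⇒EntryStep : ∀ {M w s} → nonValueWeight M ≡ 1ℚ → StepTyping (stepT M) w s 𝟎 → EntryStep M w s
StepTyping⇒EntryStep {w = w} nonValue (stepTyping {W = W} r (perm c) eW eS) with Perm-[]ˡ c
... | refl = entryStep (TypedMD⇒ZeroTypedMD r refl) (subst (λ x → w ≤ x + W) (sym nonValue) eW) (forgetWeight eS)
  where
  forgetWeight : ∀ {s v ss} → All (_<ℕ s) ss ⊎ (s ≡ 0 × v ≡ 0ℚ × [] ≈D 𝟎 × All (_≡ 0) ss) → SizesBelow s ss
  forgetWeight (inj₁ below) = inj₁ below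
  forgetWeight (inj₂ (s≡0 , _ , _ , zeros)) = inj₂ (s≡0 , zeros)

stepEntry : ∀ (M : Tm 0) {w s} → [] ⊢T[ s ] w ∣ M ∶ 𝟎 → EntryStep M w s
stepEntry (val V) d with invVal d
... | byZero refl refl c = entryStep (cons 0≤1 zeroR []) QP.≤-refl (inj₂ (refl , refl ∷ []))
... | byVal dV (perm c) with Perm-[]ʳ c
... | ()
stepEntry (app U W) d = StepTyping⇒EntryStep refl (subjectReduction (app U W) nApp d)
stepEntry (M ⊕ N) d = StepTyping⇒EntryStep refl (subjectReduction (M ⊕ N) nPlus d)
stepEntry (letin N M) d = StepTyping⇒EntryStep refl (subjectReduction (letin N M) nLet d)

-- Termination measure

-- sizeMeasure (s + 1) exceeds sizeMeasure a + sizeMeasure b for a, b ≤ s, so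
-- replacing an entry by at most two entries of smaller sizes decreases the
-- measure.
sizeMeasure : ℕ → ℕ
sizeMeasure zero = 0
sizeMeasure (suc n) = suc (suc (sizeMeasure n +ℕ sizeMeasure n +ℕ sizeMeasure n))

measure : List ℕ → ℕ
measure [] = 0
measure (s ∷ ss) = sizeMeasure s +ℕ measure ss

Decreases : ℕ → ℕ → Set
Decreases a b = a <ℕ b ⊎ (a ≡ 0 × b ≡ 0)

sizeMeasure-mono : ∀ {a b} → a ≤ℕ b → sizeMeasure a ≤ℕ sizeMeasure b
sizeMeasure-mono z≤n = z≤n
sizeMeasure-mono (s≤s le) = s≤s (s≤s (NP.+-mono-≤ (NP.+-mono-≤ (sizeMeasure-mono le) (sizeMeasure-mono le)) (sizeMeasure-mono le)))

sizeMeasure-0 : ∀ s → sizeMeasure s ≡ 0 → s ≡ 0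
sizeMeasure-0 zero e = refl

measure-zeros : ∀ {ss} → All (_≡ 0) ss → measure ss ≡ 0
measure-zeros [] = refl
measure-zeros (refl ∷ a) = measure-zeros a

measure-++ : ∀ xs ys → measure (xs ++ ys) ≡ measure xs +ℕ measure ys
measure-++ [] ys = refl
measure-++ (x ∷ xs) ys = ≡trans (cong (sizeMeasure x +ℕ_) (measure-++ xs ys)) (sym (NP.+-assoc (sizeMeasure x) (measure xs) (measure ys)))

measure-≤2-below : ∀ n ss → length ss ≤ℕ 2 → All (_<ℕ suc n) ss → measure ss ≤ℕ sizeMeasure n +ℕ sizeMeasure n
measure-≤2-below n [] _ [] = z≤n
measure-≤2-below n (a ∷ []) _ (s≤s a≤n ∷ []) = begin
  sizeMeasure a +ℕ 0             ≡⟨ NP.+-identityʳ _ ⟩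
  sizeMeasure a                  ≤⟨ sizeMeasure-mono a≤n ⟩
  sizeMeasure n                  ≤⟨ NP.m≤m+n _ _ ⟩
  sizeMeasure n +ℕ sizeMeasure n ∎
  where open NP.≤-Reasoning
measure-≤2-below n (a ∷ b ∷ []) _ (s≤s a≤n ∷ s≤s b≤n ∷ []) =
  NP.+-mono-≤ (sizeMeasure-mono a≤n) (NP.≤-trans (NP.≤-reflexive (NP.+-identityʳ _)) (sizeMeasure-mono b≤n))
measure-≤2-below n (_ ∷ _ ∷ _ ∷ _) (s≤s (s≤s ())) _

measure-step : ∀ s ss → length ss ≤ℕ 2 → SizesBelow s ss → Decreases (measure ss) (sizeMeasure s)
measure-step s ss _ (inj₂ (refl , zeros)) = inj₂ (measure-zeros zeros , refl)
measure-step zero [] _ (inj₁ []) = inj₂ (refl , refl)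
measure-step zero (_ ∷ _) _ (inj₁ (() ∷ _))
measure-step (suc n) ss length≤2 (inj₁ below) =
  inj₁ (s≤s (NP.≤-trans (measure-≤2-below n ss length≤2 below) (NP.≤-trans (NP.m≤m+n _ (sizeMeasure n)) (NP.n≤1+n _))))

Decreases-+ : ∀ {a b c d} → Decreases a b → Decreases c d → Decreases (a +ℕ c) (b +ℕ d)
Decreases-+ (inj₁ a<b) (inj₁ c<d) = inj₁ (NP.+-mono-≤-< (NP.<⇒≤ a<b) c<d)
Decreases-+ {a} {b} (inj₁ a<b) (inj₂ (refl , refl)) = inj₁ (subst₂ _<ℕ_ (sym (NP.+-identityʳ a)) (sym (NP.+-identityʳ b)) a<b)
Decreases-+ (inj₂ (refl , refl)) (inj₁ c<d) = inj₁ c<d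
Decreases-+ (inj₂ (refl , refl)) (inj₂ (refl , refl)) = inj₂ (refl , refl)

mutual
  ⊢A-size≢0 : ∀ {n} {Γ : Ctx n} {w s V A} → Γ ⊢A[ s ] w ∣ V ∶ A → s ≢ 0
  ⊢A-size≢0 (lamR d) ()
  ⊢A-size≢0 (convA d _ _) = ⊢A-size≢0 d

  ⊢I-size0⇒weight0 : ∀ {n} {Γ : Ctx n} {w s V 𝓜} → Γ ⊢I[ s ] w ∣ V ∶ 𝓜 → s ≡ 0 → w ≡ 0ℚ
  ⊢I-size0⇒weight0 varR _ = refl
  ⊢I-size0⇒weight0 (bangR b) = Bangˢ-size0⇒weight0 b
  ⊢I-size0⇒weight0 (convI d _ _) = ⊢I-size0⇒weight0 d

  Bangˢ-size0⇒weight0 : ∀ {n} {Γ : Ctx n} {w s V 𝓜} → Bangˢ V Γ w s 𝓜 → s ≡ 0 → w ≡ 0ℚ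
  Bangˢ-size0⇒weight0 none _ = refl
  Bangˢ-size0⇒weight0 (more {s = s} d b) s+s'≡0 = ⊥-elim (⊢A-size≢0 d (NP.m+n≡0⇒m≡0 s s+s'≡0))

⊢T-size0⇒weight0 : ∀ {n} {Γ : Ctx n} {w s M a} → Γ ⊢T[ s ] w ∣ M ∶ a → s ≡ 0 → w ≡ 0ℚ
⊢T-size0⇒weight0 zeroR _ = refl
⊢T-size0⇒weight0 (valR d) = ⊢I-size0⇒weight0 d
⊢T-size0⇒weight0 (convT d _ _) = ⊢T-size0⇒weight0 d

measure0⇒weight0 : ∀ {m W ss} → ZeroTypedMD m W ss → measure ss ≡ 0 → W ≡ 0ℚ
measure0⇒weight0 [] _ = refl
measure0⇒weight0 (cons {p} {s = s} _ d t) e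
  with ⊢T-size0⇒weight0 d (sizeMeasure-0 s (NP.m+n≡0⇒m≡0 (sizeMeasure s) e)) | measure0⇒weight0 t (NP.m+n≡0⇒n≡0 (sizeMeasure s) e)
... | refl | refl = ≡trans (QP.+-identityʳ (p * 0ℚ)) (QP.*-zeroʳ p)

nonValueMass : MDist → ℚ
nonValueMass [] = 0ℚ
nonValueMass ((p , M) ∷ m) = p * nonValueWeight M + nonValueMass m

record LiftTyping (m : MDist) (W : ℚ) (ss : List ℕ) : Set where
  constructor liftTyping
  field
    {W'} : ℚ
    {ss'} : List ℕ
    t : ZeroTypedMD (lift m) W' ss'
    eW : W ≤ nonValueMass m + W'
    eS : Decreases (measure ss') (measure ss)

ZeroTypedMD-lift : ∀ {m W ss} → ZeroTypedMD m W ss → LiftTyping m W ss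
ZeroTypedMD-lift [] = liftTyping [] QP.≤-refl (inj₂ (refl , refl))
ZeroTypedMD-lift (cons {p} {M} {w} {s} {m} {W} {ss} p≥0 d t) with stepEntry M d | ZeroTypedMD-lift t
... | entryStep {W₁} {ss₁} t₁ eW₁ eS₁ | liftTyping {W₂} {ss₂} t₂ eW₂ eS₂ =
  liftTyping (ZeroTypedMD-++ (ZeroTypedMD-scale p p≥0 t₁) t₂) weight
    (subst (λ x → Decreases x (sizeMeasure s +ℕ measure ss)) (sym (measure-++ ss₁ ss₂))
      (Decreases-+ (measure-step s ss₁ (NP.≤-trans (NP.≤-reflexive (ZeroTypedMD-length t₁)) (length-stepT≤2 M)) eS₁) eS₂))
  where
  open QP.≤-Reasoning
  weight : p * w + W ≤ (p * nonValueWeight M + nonValueMass m) + (p * W₁ + W₂)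
  weight = begin
    p * w + W                                                  ≤⟨ QP.+-mono-≤ (QP.*-monoˡ-≤-nonNeg p {{nonNegative p≥0}} eW₁) eW₂ ⟩
    p * (nonValueWeight M + W₁) + (nonValueMass m + W₂)        ≡⟨ solve 5 (λ p a W₁ b W₂ → p :* (a :+ W₁) :+ (b :+ W₂) := (p :* a :+ b) :+ (p :* W₁ :+ W₂)) refl
                                                                    p (nonValueWeight M) W₁ (nonValueMass m) W₂ ⟩
    (p * nonValueWeight M + nonValueMass m) + (p * W₁ + W₂)    ∎

entryMass-split : ∀ p M → p ≡ valueWeight (p , M) + p * nonValueWeight M
entryMass-split p (val V) = sym (≡trans (cong (p +_) (QP.*-zeroʳ p)) (QP.+-identityʳ p))
entryMass-split p (app V W) = sym (≡trans (QP.+-identityˡ _) (QP.*-identityʳ p))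
entryMass-split p (M ⊕ N) = sym (≡trans (QP.+-identityˡ _) (QP.*-identityʳ p))
entryMass-split p (letin N M) = sym (≡trans (QP.+-identityˡ _) (QP.*-identityʳ p))

mass-split : ∀ m → mass m ≡ valueMass m + nonValueMass m
mass-split [] = refl
mass-split ((p , M) ∷ m) =
  ≡trans (cong₂ _+_ (entryMass-split p M) (mass-split m))
    (ℚ+.interchange (valueWeight (p , M)) (p * nonValueWeight M) (valueMass m) (nonValueMass m))

nonValueMass-mseq : ∀ M j → nonValueMass (mseq M j) ≡ 1ℚ - 𝒫 j M
nonValueMass-mseq M j = isDifference 1ℚ (𝒫 j M) _ (≡trans (sym (mass-mseq M j)) (mass-split (mseq M j)))
  where
  isDifference : ∀ a b c → a ≡ b + c → c ≡ a - b
  isDifference _ b c refl = solve 2 (λ b c → c := (b :+ c) :- b) refl b c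

ℰ-bound : ∀ (B : ℕ) (M : Tm 0) j {W ss} → measure ss <ℕ B → ZeroTypedMD (mseq M j) W ss → Σ ℕ λ k → ℰ j M + W ≤ ℰ k M
ℰ-bound (suc B) M j {W} {ss} (s≤s lb) t with ZeroTypedMD-lift t
... | liftTyping {W'} t' eW (inj₁ decreases) with ℰ-bound B M (suc j) (NP.<-≤-trans decreases lb) t'
... | k , bound = k , (begin
  ℰ j M + W                                ≤⟨ QP.+-monoʳ-≤ (ℰ j M) eW ⟩
  ℰ j M + (nonValueMass (mseq M j) + W')   ≡⟨ cong (λ x → ℰ j M + (x + W')) (nonValueMass-mseq M j) ⟩
  ℰ j M + ((1ℚ - 𝒫 j M) + W')             ≡⟨ sym (QP.+-assoc (ℰ j M) _ W') ⟩
  ℰ (suc j) M + W'                         ≤⟨ bound ⟩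
  ℰ k M                                    ∎)
  where open QP.≤-Reasoning
ℰ-bound (suc B) M j (s≤s lb) t | liftTyping t' eW (inj₂ (_ , measure≡0)) with measure0⇒weight0 t measure≡0
... | refl = j , QP.≤-reflexive (QP.+-identityʳ (ℰ j M))

mainTheorem8 : (M : Tm 0) (w : ℚ) → ∅ ⊢T w ∣ M ∶ 𝟎 → ∃ λ (k : ℕ) → w ≤ ℰ k M
mainTheorem8 M w d =
  let (s , d') = sizedT d
      (k , bound) = ℰ-bound (suc (measure (s ∷ []))) M 0 NP.≤-refl (cons 0≤1 d' [])
  in k , QP.≤-trans (QP.≤-reflexive singletonWeight) bound
  where
  singletonWeight : w ≡ 0ℚ + (1ℚ * w + 0ℚ)
  singletonWeight = solve 1 (λ w → w := con 0ℚ :+ (con 1ℚ :* w :+ con 0ℚ)) refl w
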